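{- With the notation below, \[ \frac{d}{dx}\widehat A_k(x)=\frac{2}{1-x}\widehat A_k(x)+\frac{d}{dx}\widehat B_k(x)\quad(k\ge0),\qquad \frac{d}{dx}\widehat B_k(x)=2\bigl[1+B_{\ge k-1}(x)\bigr]\widehat B_{k-1}(x)\quad(k>0), \] with $\widehat B_0(x)=x$. Consequently $g_k=2\int_0^1(1-x)\,\widehat B_k(x)\,dx$.
   Context: For a permutation $p$ of $[n]$, the decreasing binary tree $T(p)$ has root labelled $n$, left subtree $T(p')$ and right subtree $T(p'')$ where $p',p''$ are the substrings of $p$ to the left and right of $n$ (an empty substring gives no child). The random tree $T_n$ is $T(p)$ for uniformly random $p$. The rank $R(v)$ of a vertex $v$ is the number of edges in a shortest path from $v$ to a descendant leaf of $v$ (a vertex counts as its own descendant). $\mathcal L_n$ is the number of leaves of $T_n$ at minimal distance from the root. $G_{n,k}$ is the expected number of pairs $(v,u)$ in $T_n$ with $v$ of rank $k$ and $u$ a descendant leaf of $v$ closest to $v$; $g_{n,k}=\mathrm{E}\bigl[\mathbf 1_{\{R(\mathrm{root})=k\}}\mathcal L_n\bigr]$. Set $\widehat A_k(x)=\sum_{n\ge1}G_{n,k}x^n$, $\widehat B_k(x)=\sum_{n\ge1}g_{n,k}x^n$, and $B_{\ge t}(x)=\sum_{n\ge1}\mathrm{P}(R(\mathrm{root\ of\ }T_n)\ge t)\,x^n$. For each $k$ the finite limit $g_k=\lim_{n\to\infty}G_{n,k}/n$ exists. -}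

module Defs where

open import Data.Nat as ℕ using (ℕ; zero; suc; _⊔_; _⊓_; _!; _∸_)
open import Data.Nat.Properties using (_!≢0)
open import Data.Integer using (+_)
open import Data.Rational using (ℚ; _/_; 0ℚ; 1ℚ; _+_; _*_; -_)
open import Data.List using (List; []; _∷_; concatMap; length; foldr; map; span)
open import Data.Bool using (Bool; true; false; if_then_else_)
open import Relation.Nullary.Decidable using (does; ¬?)
open import Data.Product using (_×_; _,_)

insertEverywhere : ℕ → List ℕ → List (List ℕ)
insertEverywhere a []       = (a ∷ []) ∷ []
insertEverywhere a (x ∷ xs) = (a ∷ x ∷ xs) ∷ map (x ∷_) (insertEverywhere a xs)

perms : ℕ → List (List ℕ)
perms zero    = [] ∷ []
perms (suc n) = concatMap (insertEverywhere (suc n)) (perms n)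

data Tree : Set where
  nil  : Tree
  node : Tree → ℕ → Tree → Tree

maxL : List ℕ → ℕ
maxL = foldr _⊔_ 0

splitAtMax : List ℕ → List ℕ × List ℕ
splitAtMax xs with span (λ x → ¬? (x ℕ.≟ maxL xs)) xs
... | (l , [])    = (l , [])
... | (l , _ ∷ r) = (l , r)

-- T(p), using fuel = length p (enough since every recursive call shrinks the list)
buildF : ℕ → List ℕ → Tree
buildF _        []       = nil
buildF zero     (_ ∷ _)  = nil
buildF (suc f)  (x ∷ xs) with splitAtMax (x ∷ xs)
... | (l , r) = node (buildF f l) (maxL (x ∷ xs)) (buildF f r)

T : List ℕ → Tree
T p = buildF (length p) p

-- rank of (the root of) a nonempty tree: distance to the nearest descendant leaf
rank : Tree → ℕ
rank nil                    = 0   -- unused convention (empty tree has no root)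
rank (node nil _ nil)       = 0
rank (node l@(node _ _ _) _ nil) = suc (rank l)
rank (node nil _ r@(node _ _ _)) = suc (rank r)
rank (node l _ r)           = suc (rank l ⊓ rank r)

leavesAt : ℕ → Tree → ℕ
leavesAt _       nil              = 0
leavesAt zero    (node nil _ nil) = 1
leavesAt zero    (node _ _ _)     = 0
leavesAt (suc d) (node l _ r)     = leavesAt d l ℕ.+ leavesAt d r

closestLeaves : Tree → ℕ
closestLeaves t = leavesAt (rank t) t

-- number of pairs (v,u): v of rank k, u a descendant leaf of v closest to v
pairs : ℕ → Tree → ℕ
pairs k nil = 0
pairs k t@(node l _ r) =
  (if does (rank t ℕ.≟ k) then closestLeaves t else 0) ℕ.+ pairs k l ℕ.+ pairs k r

sumL : List ℕ → ℕ
sumL = foldr ℕ._+_ 0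

E : ℕ → (Tree → ℕ) → ℚ
E n f = _/_ (+ sumL (map (λ p → f (T p)) (perms n))) (n !) {{n !≢0}}

G : ℕ → ℕ → ℚ
G n k = E n (pairs k)

g : ℕ → ℕ → ℚ
g n k = E n (λ t → if does (rank t ℕ.≟ k) then closestLeaves t else 0)

Pge : ℕ → ℕ → ℚ
Pge n t = E n (λ s → if does (t ℕ.≤? rank s) then 1 else 0)

FPS : Set
FPS = ℕ → ℚ

fromℕℚ : ℕ → ℚ
fromℕℚ n = + n / 1

sumTo : ℕ → (ℕ → ℚ) → ℚ
sumTo zero    f = 0ℚ
sumTo (suc n) f = sumTo n f + f n

_⊕_ : FPS → FPS → FPS
(f ⊕ h) n = f n + h n

_⊗_ : FPS → FPS → FPS
(f ⊗ h) n = sumTo (suc n) (λ i → f i * h (n ∸ i))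

scale : ℚ → FPS → FPS
scale c f n = c * f n

deriv : FPS → FPS
deriv f n = fromℕℚ (suc n) * f (suc n)

oneS : FPS
oneS zero    = 1ℚ
oneS (suc _) = 0ℚ

xS : FPS
xS 1 = 1ℚ
xS _ = 0ℚ

geom : FPS
geom _ = 1ℚ

oneMinusX : FPS
oneMinusX zero = 1ℚ
oneMinusX 1    = - 1ℚ
oneMinusX _    = 0ℚ

series≥1 : (ℕ → ℚ) → FPS
series≥1 a zero    = 0ℚ
series≥1 a (suc n) = a (suc n)

Ahat : ℕ → FPS
Ahat k = series≥1 (λ n → G n k)

Bhat : ℕ → FPS
Bhat k = series≥1 (λ n → g n k)

Bge : ℕ → FPS
Bge t = series≥1 (λ n → Pge n t)

-- partial termwise integral of (1-x) f(x) over [0,1]: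
--   Σ_{m<M} f_m ∫_0^1 (1-x) x^m dx = Σ_{m<M} f_m / ((m+1)(m+2))
intOneMinusX : FPS → ℕ → ℚ
intOneMinusX f M = sumTo M (λ m → f m * (+ 1 / (suc m ℕ.* suc (suc m))))

two : ℚ
two = + 2 / 1

-- The shapes of T_{n+1} arise from those of T_n by adding a new
-- maximum at one of n + 1 positions, which cuts the tree along its symmetric order;
-- by induction, a uniform T_n cut at position i falls into independent uniform T_i
-- and T_{n-i}. Hence the root of T_{n+1} has a left subtree of size uniform on
-- 0, …, n, with independent uniform subtrees. Conditioning on it turns the additive
-- count of pairs and the multiplicative count at the root into the two recurrences.
-- The first one solves to G_n = g_n + 2 (n + 1) I_n with I_n = Σ_{m<n} g_m / ((m+1)(m+2)),
-- and since 0 ≤ g_m ≤ 2^k, I_n is Cauchy with tails at most 2^k / n, so G_n / n → 2 lim I_n.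

module Submission where

module Shapes where

  open import Data.Bool using (if_then_else_)
  open import Data.Empty using (⊥-elim)
  open import Data.Nat using (ℕ; zero; suc; _+_; _∸_; _≤_; _≤?_; _≟_; _⊓_; z≤n)
  open import Data.Nat.Properties
    using (+-suc; +-assoc; m+[n∸m]≡n; m+n∸m≡n; +-cancelˡ-≤; ≰⇒>; m≤m+n; ≤-trans
          ; m+n≤o⇒m≤o∸n; m≤o∸n⇒m+n≤o; +-comm; [m+n]∸[m+o]≡n∸o; +-∸-comm)
  open import Data.Product using (_×_; _,_; proj₁; proj₂)
  open import Relation.Nullary using (¬_; yes; no; does)
  open import Relation.Binary.PropositionalEquality
  open ≡-Reasoning

  open import Defs

  size : Tree → ℕ
  size nil          = 0
  size (node l _ r) = suc (size l + size r)

  shape : Tree → Tree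
  shape nil          = nil
  shape (node l _ r) = node (shape l) 0 (shape r)

  join : Tree × Tree → Tree
  join (l , r) = node l 0 r

  -- splitAt i t = (the first i vertices of t in symmetric order, the others), each
  -- as a tree keeping the ancestor relations among its vertices. On decreasing
  -- trees this is T p ↦ (T (take i p) , T (drop i p)), and join (splitAt i t)
  -- inserts a new maximum at position i.
  splitAt : ℕ → Tree → Tree × Tree
  splitAt i nil = nil , nil
  splitAt i (node l v r) with i ≤? size l
  ... | yes _ = proj₁ (splitAt i l) , node (proj₂ (splitAt i l)) v r
  ... | no _  = node l v (proj₁ (splitAt (i ∸ suc (size l)) r)) , proj₂ (splitAt (i ∸ suc (size l)) r)

  takeT : ℕ → Tree → Tree
  takeT i t = proj₁ (splitAt i t)

  dropT : ℕ → Tree → Tree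
  dropT i t = proj₂ (splitAt i t)

  splitAt-≤ : ∀ {i l v r} → i ≤ size l → splitAt i (node l v r) ≡ (takeT i l , node (dropT i l) v r)
  splitAt-≤ {i} {l} i≤ with i ≤? size l
  ... | yes _ = refl
  ... | no i≰ = ⊥-elim (i≰ i≤)

  splitAt-≰ : ∀ {i l v r} → ¬ i ≤ size l →
              splitAt i (node l v r) ≡ (node l v (takeT (i ∸ suc (size l)) r) , dropT (i ∸ suc (size l)) r)
  splitAt-≰ {i} {l} i≰ with i ≤? size l
  ... | yes i≤ = ⊥-elim (i≰ i≤)
  ... | no _   = refl

  size-shape : ∀ t → size (shape t) ≡ size t
  size-shape nil          = refl
  size-shape (node l _ r) = cong₂ (λ a b → suc (a + b)) (size-shape l) (size-shape r)

  splitAt-shape : ∀ i t → splitAt i (shape t) ≡ (shape (takeT i t) , shape (dropT i t))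
  splitAt-shape i nil = refl
  splitAt-shape i (node l v r) with i ≤? size l
  ... | yes i≤
    rewrite splitAt-≤ {i} {shape l} {0} {shape r} (subst (i ≤_) (sym (size-shape l)) i≤)
          | splitAt-shape i l = refl
  ... | no i≰
    rewrite splitAt-≰ {i} {shape l} {0} {shape r} (λ i≤ → i≰ (subst (i ≤_) (size-shape l) i≤))
          | size-shape l | splitAt-shape (i ∸ suc (size l)) r = refl

  size-splitAt : ∀ i t → size (takeT i t) + size (dropT i t) ≡ size t
  size-splitAt i nil = refl
  size-splitAt i (node l v r) with i ≤? size l
  ... | yes i≤ = begin
    size (takeT i l) + suc (size (dropT i l) + size r)   ≡⟨ +-suc _ _ ⟩
    suc (size (takeT i l) + (size (dropT i l) + size r)) ≡⟨ cong suc (+-assoc (size (takeT i l)) _ _) ⟨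
    suc (size (takeT i l) + size (dropT i l) + size r)   ≡⟨ cong (λ z → suc (z + size r)) (size-splitAt i l) ⟩
    suc (size l + size r)                                ∎
  ... | no i≰ = begin
    suc (size l + size (takeT j r)) + size (dropT j r)   ≡⟨ cong suc (+-assoc (size l) _ _) ⟩
    suc (size l + (size (takeT j r) + size (dropT j r))) ≡⟨ cong (λ z → suc (size l + z)) (size-splitAt j r) ⟩
    suc (size l + size r)                                ∎
    where j = i ∸ suc (size l)

  size-takeT : ∀ i t → i ≤ size t → size (takeT i t) ≡ i
  size-takeT i nil z≤n = refl
  size-takeT i (node l v r) i≤ with i ≤? size l
  ... | yes i≤l = size-takeT i l i≤l
  ... | no i≰l =
    trans (cong (λ z → suc (size l + z)) (size-takeT j r j≤)) (m+[n∸m]≡n l<i)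
    where
    j = i ∸ suc (size l)
    l<i = ≰⇒> i≰l
    j≤ : j ≤ size r
    j≤ = +-cancelˡ-≤ (suc (size l)) j (size r) (subst (_≤ suc (size l + size r)) (sym (m+[n∸m]≡n l<i)) i≤)

  size-dropT : ∀ i t → i ≤ size t → size (dropT i t) ≡ size t ∸ i
  size-dropT i t i≤ = begin
    size (dropT i t)                                      ≡⟨ m+n∸m≡n (size (takeT i t)) _ ⟨
    size (takeT i t) + size (dropT i t) ∸ size (takeT i t) ≡⟨ cong₂ _∸_ (size-splitAt i t) (size-takeT i t i≤) ⟩
    size t ∸ i                                            ∎

  m∸[1+o∸n]≡[n+m]∸[1+o] : ∀ m {n o} → n ≤ o → m ∸ suc (o ∸ n) ≡ n + m ∸ suc o
  m∸[1+o∸n]≡[n+m]∸[1+o] m {n} {o} n≤o = begin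
    m ∸ suc (o ∸ n)           ≡⟨ [m+n]∸[m+o]≡n∸o n m (suc (o ∸ n)) ⟨
    n + m ∸ (n + suc (o ∸ n)) ≡⟨ cong (λ z → n + m ∸ z) (trans (+-suc n _) (cong suc (m+[n∸m]≡n n≤o))) ⟩
    n + m ∸ suc o             ∎

  splitAt-+ : ∀ t i m → splitAt i (takeT (i + m) t) ≡ (takeT i t , takeT m (dropT i t))
                      × dropT (i + m) t ≡ dropT m (dropT i t)
  splitAt-+ nil i m = refl , refl
  splitAt-+ (node l v r) i m with i + m ≤? size l | i ≤? size l
  ... | yes i+m≤ | no i≰ = ⊥-elim (i≰ (≤-trans (m≤m+n i m) i+m≤))
  ... | yes i+m≤ | yes i≤
    rewrite splitAt-≤ {m} {dropT i l} {v} {r}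
              (subst (m ≤_) (sym (size-dropT i l i≤)) (m+n≤o⇒m≤o∸n m (subst (_≤ size l) (+-comm i m) i+m≤)))
    = proj₁ (splitAt-+ l i m) , cong (λ z → node z v r) (proj₂ (splitAt-+ l i m))
  ... | no i+m≰ | yes i≤
    rewrite splitAt-≤ {i} {l} {v} {takeT (i + m ∸ suc (size l)) r} i≤
          | splitAt-≰ {m} {dropT i l} {v} {r}
              (subst (λ z → ¬ m ≤ z) (sym (size-dropT i l i≤))
                     (λ m≤ → i+m≰ (subst (_≤ size l) (+-comm m i) (m≤o∸n⇒m+n≤o m i≤ m≤))))
          | size-dropT i l i≤ | m∸[1+o∸n]≡[n+m]∸[1+o] m i≤ = refl , refl
  ... | no i+m≰ | no i≰
    rewrite splitAt-≰ {i} {l} {v} {takeT (i + m ∸ suc (size l)) r} i≰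
          | +-∸-comm {i} m {suc (size l)} (≰⇒> i≰)
    = cong₂ _,_ (cong (λ z → node l v (proj₁ z)) rest) (cong proj₂ rest) , proj₂ (splitAt-+ r (i ∸ suc (size l)) m)
    where rest = proj₁ (splitAt-+ r (i ∸ suc (size l)) m)

  rank-shape : ∀ t → rank (shape t) ≡ rank t
  rank-shape nil                                   = refl
  rank-shape (node nil _ nil)                      = refl
  rank-shape (node l@(node _ _ _) _ nil)           = cong suc (rank-shape l)
  rank-shape (node nil _ r@(node _ _ _))           = cong suc (rank-shape r)
  rank-shape (node l@(node _ _ _) _ r@(node _ _ _)) = cong₂ (λ x y → suc (x ⊓ y)) (rank-shape l) (rank-shape r)

  leavesAt-shape : ∀ d t → leavesAt d (shape t) ≡ leavesAt d t
  leavesAt-shape _       nil                         = refl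
  leavesAt-shape zero    (node nil _ nil)            = refl
  leavesAt-shape zero    (node (node _ _ _) _ _)     = refl
  leavesAt-shape zero    (node nil _ (node _ _ _))   = refl
  leavesAt-shape (suc d) (node l _ r) = cong₂ _+_ (leavesAt-shape d l) (leavesAt-shape d r)

  closestLeaves-shape : ∀ t → closestLeaves (shape t) ≡ closestLeaves t
  closestLeaves-shape t rewrite rank-shape t = leavesAt-shape (rank t) t

  rootPairs : ℕ → Tree → ℕ
  rootPairs k t = if does (rank t ≟ k) then closestLeaves t else 0

  rootPairs-shape : ∀ k t → rootPairs k (shape t) ≡ rootPairs k t
  rootPairs-shape k t = cong₂ (λ a b → if does (a ≟ k) then b else 0) (rank-shape t) (closestLeaves-shape t)

  pairs-shape : ∀ k t → pairs k (shape t) ≡ pairs k t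
  pairs-shape k nil = refl
  pairs-shape k t@(node l v r) =
    cong₂ _+_ (cong₂ _+_ (rootPairs-shape k t) (pairs-shape k l)) (pairs-shape k r)

module Sums where

  open import Data.Nat using (ℕ; zero; suc; _+_; _*_; _≤_; _<_; z≤n)
  open import Data.Nat.Properties
    using (+-assoc; +-identityʳ; +-suc; +-comm; *-zeroʳ; *-distribˡ-+; *-distribʳ-+; +-mono-≤
          ; m<n⇒m<1+n; n<1+n)
  open import Data.Nat.Solver using (module +-*-Solver)
  open import Data.List using (List; []; _∷_; _++_; map; concatMap; length)
  open import Data.List.Properties using (map-++; ++-identityʳ; ++-assoc; length-++)
  open import Data.List.Relation.Unary.All as All using (All; []; _∷_)
  open import Data.List.Relation.Unary.All.Properties using (++⁺)
  open import Relation.Binary.PropositionalEquality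
  open ≡-Reasoning
  open +-*-Solver

  open import Defs using (sumL)

  ∑ : ∀ {A : Set} → List A → (A → ℕ) → ℕ
  ∑ xs f = sumL (map f xs)

  module _ {A : Set} where

    ∑-++ : ∀ (xs ys : List A) f → ∑ (xs ++ ys) f ≡ ∑ xs f + ∑ ys f
    ∑-++ []       ys f = refl
    ∑-++ (x ∷ xs) ys f = trans (cong (f x +_) (∑-++ xs ys f)) (sym (+-assoc (f x) _ _))

    ∑-cong : ∀ (xs : List A) {f g} → (∀ x → f x ≡ g x) → ∑ xs f ≡ ∑ xs g
    ∑-cong []       f≡g = refl
    ∑-cong (x ∷ xs) f≡g = cong₂ _+_ (f≡g x) (∑-cong xs f≡g)

    ∑-cong-All : ∀ {P : A → Set} {xs : List A} {f g} → All P xs → (∀ {x} → P x → f x ≡ g x) → ∑ xs f ≡ ∑ xs g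
    ∑-cong-All []       f≡g = refl
    ∑-cong-All (p ∷ ps) f≡g = cong₂ _+_ (f≡g p) (∑-cong-All ps f≡g)

    ∑-+ : ∀ (xs : List A) f g → ∑ xs (λ x → f x + g x) ≡ ∑ xs f + ∑ xs g
    ∑-+ []       f g = refl
    ∑-+ (x ∷ xs) f g rewrite ∑-+ xs f g =
      solve 4 (λ a b c d → (a :+ b) :+ (c :+ d) := (a :+ c) :+ (b :+ d)) refl (f x) (g x) (∑ xs f) (∑ xs g)

    ∑-*ˡ : ∀ (xs : List A) c f → ∑ xs (λ x → c * f x) ≡ c * ∑ xs f
    ∑-*ˡ []       c f = sym (*-zeroʳ c)
    ∑-*ˡ (x ∷ xs) c f rewrite ∑-*ˡ xs c f = sym (*-distribˡ-+ c (f x) (∑ xs f))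

    ∑-*ʳ : ∀ (xs : List A) c f → ∑ xs (λ x → f x * c) ≡ ∑ xs f * c
    ∑-*ʳ []       c f = refl
    ∑-*ʳ (x ∷ xs) c f rewrite ∑-*ʳ xs c f = sym (*-distribʳ-+ c (f x) (∑ xs f))

    ∑-const : ∀ (xs : List A) c → ∑ xs (λ _ → c) ≡ length xs * c
    ∑-const []       c = refl
    ∑-const (x ∷ xs) c = cong (c +_) (∑-const xs c)

    ∑-zero : ∀ (xs : List A) → ∑ xs (λ _ → 0) ≡ 0
    ∑-zero xs = trans (∑-const xs 0) (*-zeroʳ (length xs))

    ∑-≤ : ∀ (xs : List A) {f c} → (∀ x → f x ≤ c) → ∑ xs f ≤ length xs * c
    ∑-≤ []       f≤c = z≤n
    ∑-≤ (x ∷ xs) f≤c = +-mono-≤ (f≤c x) (∑-≤ xs f≤c)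

  ∑-map : ∀ {A B : Set} (g : A → B) (xs : List A) f → ∑ (map g xs) f ≡ ∑ xs (λ x → f (g x))
  ∑-map g []       f = refl
  ∑-map g (x ∷ xs) f = cong (f (g x) +_) (∑-map g xs f)

  ∑-concatMap : ∀ {A B : Set} (g : A → List B) (xs : List A) f → ∑ (concatMap g xs) f ≡ ∑ xs (λ x → ∑ (g x) f)
  ∑-concatMap g []       f = refl
  ∑-concatMap g (x ∷ xs) f = trans (∑-++ (g x) (concatMap g xs) f) (cong (∑ (g x) f +_) (∑-concatMap g xs f))

  ∑-comm : ∀ {A B : Set} (xs : List A) (ys : List B) (f : A → B → ℕ) →
           ∑ xs (λ x → ∑ ys (f x)) ≡ ∑ ys (λ y → ∑ xs (λ x → f x y))
  ∑-comm []       ys f = sym (∑-zero ys)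
  ∑-comm (x ∷ xs) ys f =
    trans (cong (∑ ys (f x) +_) (∑-comm xs ys f)) (sym (∑-+ ys (f x) (λ y → ∑ xs (λ z → f z y))))

  length-concatMap : ∀ {A B : Set} (g : A → List B) (xs : List A) → length (concatMap g xs) ≡ ∑ xs (λ x → length (g x))
  length-concatMap g []       = refl
  length-concatMap g (x ∷ xs) = trans (length-++ (g x)) (cong (length (g x) +_) (length-concatMap g xs))

  range : ℕ → List ℕ
  range zero    = []
  range (suc n) = range n ++ n ∷ []

  range-suc : ∀ n → range (suc n) ≡ 0 ∷ map suc (range n)
  range-suc zero    = refl
  range-suc (suc n) = begin
    range (suc n) ++ suc n ∷ []          ≡⟨ cong (_++ suc n ∷ []) (range-suc n) ⟩
    0 ∷ (map suc (range n) ++ suc n ∷ []) ≡⟨ cong (0 ∷_) (map-++ suc (range n) (n ∷ [])) ⟨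
    0 ∷ map suc (range (suc n))          ∎

  range-+ : ∀ i j → range (i + j) ≡ range i ++ map (i +_) (range j)
  range-+ i zero    = trans (cong range (+-identityʳ i)) (sym (++-identityʳ (range i)))
  range-+ i (suc j) = begin
    range (i + suc j)                             ≡⟨ cong range (+-suc i j) ⟩
    range (i + j) ++ i + j ∷ []                   ≡⟨ cong (_++ i + j ∷ []) (range-+ i j) ⟩
    (range i ++ map (i +_) (range j)) ++ i + j ∷ [] ≡⟨ ++-assoc (range i) _ _ ⟩
    range i ++ (map (i +_) (range j) ++ i + j ∷ []) ≡⟨ cong (range i ++_) (map-++ (i +_) (range j) (j ∷ [])) ⟨
    range i ++ map (i +_) (range (suc j))         ∎

  All-<-range : ∀ n → All (_< n) (range n)
  All-<-range zero    = []
  All-<-range (suc n) = ++⁺ (All.map m<n⇒m<1+n (All-<-range n)) (n<1+n n ∷ [])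

  length-range : ∀ n → length (range n) ≡ n
  length-range zero    = refl
  length-range (suc n) = trans (length-++ (range n)) (trans (+-comm (length (range n)) 1) (cong suc (length-range n)))

module Permutations where

  open import Data.Nat using (ℕ; zero; suc; _+_; _∸_; _≤_; _<_; _≤?_; _≟_; z≤n; s≤s)
  open import Data.Nat.Properties
    using (⊔-lub; <⇒≤; <⇒≢; m≥n⇒m⊔n≡m; m≤n⇒m⊔n≡n; +-suc; m+n≤o⇒m≤o; m+n≤o⇒n≤o
          ; m≤m+n; m≤n+m; ≤-refl; ≰⇒>; m+[n∸m]≡n; m<n⇒m<1+n; n<1+n)
  open import Data.Product using (_×_; _,_; proj₁; proj₂)
  open import Data.List using (List; []; _∷_; _++_; map; concatMap; length; take; drop; span)
  open import Data.List.Properties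
    using (map-∘; length-++; take++drop≡id; map-concatMap; concatMap-map; map-cong)
  open import Data.List.Relation.Unary.All as All using (All; []; _∷_)
  open import Data.List.Relation.Unary.All.Properties using (++⁺; take⁺; drop⁺; map⁺; concat⁺)
  open import Relation.Nullary using (¬_; yes; no; ¬?)
  open import Relation.Nullary.Decidable using (dec-true; dec-false)
  open import Function using (_∘_)
  open import Relation.Binary.PropositionalEquality
  open ≡-Reasoning

  open import Defs
  open Shapes
  open Sums using (range; range-suc)

  insertAt : ℕ → List ℕ → ℕ → List ℕ
  insertAt a xs i = take i xs ++ a ∷ drop i xs

  insertEverywhere≡map-insertAt : ∀ a xs → insertEverywhere a xs ≡ map (insertAt a xs) (range (suc (length xs)))
  insertEverywhere≡map-insertAt a []       = refl
  insertEverywhere≡map-insertAt a (x ∷ xs) = begin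
    (a ∷ x ∷ xs) ∷ map (x ∷_) (insertEverywhere a xs)
      ≡⟨ cong (λ z → (a ∷ x ∷ xs) ∷ map (x ∷_) z) (insertEverywhere≡map-insertAt a xs) ⟩
    (a ∷ x ∷ xs) ∷ map (x ∷_) (map (insertAt a xs) (range (suc (length xs))))
      ≡⟨ cong ((a ∷ x ∷ xs) ∷_) (map-∘ (range (suc (length xs)))) ⟨
    (a ∷ x ∷ xs) ∷ map (insertAt a (x ∷ xs) ∘ suc) (range (suc (length xs)))
      ≡⟨ cong ((a ∷ x ∷ xs) ∷_) (map-∘ (range (suc (length xs)))) ⟩
    map (insertAt a (x ∷ xs)) (0 ∷ map suc (range (suc (length xs))))
      ≡⟨ cong (map (insertAt a (x ∷ xs))) (range-suc (suc (length xs))) ⟨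
    map (insertAt a (x ∷ xs)) (range (suc (suc (length xs)))) ∎

  -- Distinctness of the entries, in the recursive form along which T unfolds.
  data Distinct : List ℕ → Set where
    []    : Distinct []
    atMax : ∀ {a M b} → Distinct a → Distinct b → All (_< M) a → All (_< M) b → Distinct (a ++ M ∷ b)

  maxL-≤ : ∀ {M} xs → All (_< M) xs → maxL xs ≤ M
  maxL-≤ []       []         = z≤n
  maxL-≤ (x ∷ xs) (x< ∷ xs<) = ⊔-lub (<⇒≤ x<) (maxL-≤ xs xs<)

  maxL-++-∷ : ∀ {M} a b → All (_< M) a → All (_< M) b → maxL (a ++ M ∷ b) ≡ M
  maxL-++-∷ []      b _          b< = m≥n⇒m⊔n≡m (maxL-≤ b b<)
  maxL-++-∷ (x ∷ a) b (x< ∷ a<) b< rewrite maxL-++-∷ a b a< b< = m≤n⇒m⊔n≡n (<⇒≤ x<)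

  span-++-∷ : ∀ {M} a b → All (_< M) a → span (λ x → ¬? (x ≟ M)) (a ++ M ∷ b) ≡ (a , M ∷ b)
  span-++-∷ {M} []      b _ rewrite dec-true (M ≟ M) refl = refl
  span-++-∷ {M} (x ∷ a) b (x< ∷ a<) rewrite dec-false (x ≟ M) (<⇒≢ x<) | span-++-∷ a b a< = refl

  splitAtMax-span : ∀ xs {y l r} → span (λ x → ¬? (x ≟ maxL xs)) xs ≡ (l , y ∷ r) → splitAtMax xs ≡ (l , r)
  splitAtMax-span xs eq with span (λ x → ¬? (x ≟ maxL xs)) xs | eq
  ... | _ | refl = refl

  splitAtMax-++-∷ : ∀ {M} a b → All (_< M) a → All (_< M) b → splitAtMax (a ++ M ∷ b) ≡ (a , b)
  splitAtMax-++-∷ {M} a b a< b< = splitAtMax-span (a ++ M ∷ b)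
    (subst (λ z → span (λ x → ¬? (x ≟ z)) (a ++ M ∷ b) ≡ (a , M ∷ b)) (sym (maxL-++-∷ a b a< b<)) (span-++-∷ a b a<))

  buildF-∷ : ∀ f x xs → buildF (suc f) (x ∷ xs) ≡
    node (buildF f (proj₁ (splitAtMax (x ∷ xs)))) (maxL (x ∷ xs)) (buildF f (proj₂ (splitAtMax (x ∷ xs))))
  buildF-∷ f x xs with splitAtMax (x ∷ xs)
  ... | (l , r) = refl

  buildF-++-∷ : ∀ f a M b → All (_< M) a → All (_< M) b →
                buildF (suc f) (a ++ M ∷ b) ≡ node (buildF f a) M (buildF f b)
  buildF-++-∷ f a M b a< b< = begin
    buildF (suc f) (a ++ M ∷ b)
      ≡⟨ unfold a ⟩
    node (buildF f (proj₁ (splitAtMax (a ++ M ∷ b)))) (maxL (a ++ M ∷ b)) (buildF f (proj₂ (splitAtMax (a ++ M ∷ b))))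
      ≡⟨ cong₂ (λ (l , r) m → node (buildF f l) m (buildF f r)) (splitAtMax-++-∷ a b a< b<) (maxL-++-∷ a b a< b<) ⟩
    node (buildF f a) M (buildF f b) ∎
    where
    unfold : ∀ a → buildF (suc f) (a ++ M ∷ b) ≡ node (buildF f (proj₁ (splitAtMax (a ++ M ∷ b))))
               (maxL (a ++ M ∷ b)) (buildF f (proj₂ (splitAtMax (a ++ M ∷ b))))
    unfold []      = buildF-∷ f M b
    unfold (x ∷ a) = buildF-∷ f x (a ++ M ∷ b)

  length-++-∷ : ∀ (a : List ℕ) M b → length (a ++ M ∷ b) ≡ suc (length a + length b)
  length-++-∷ a M b = trans (length-++ a) (+-suc (length a) (length b))

  buildF-fuel : ∀ {xs} → Distinct xs → ∀ f f′ → length xs ≤ f → length xs ≤ f′ → buildF f xs ≡ buildF f′ xs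
  buildF-fuel []                      zero    zero     _ _ = refl
  buildF-fuel []                      zero    (suc f′) _ _ = refl
  buildF-fuel []                      (suc f) zero     _ _ = refl
  buildF-fuel []                      (suc f) (suc f′) _ _ = refl
  buildF-fuel (atMax {a} {M} {b} da db a< b<) f f′ len≤f len≤f′ =
    go f f′ (subst (_≤ f) (length-++-∷ a M b) len≤f) (subst (_≤ f′) (length-++-∷ a M b) len≤f′)
    where
    go : ∀ f f′ → suc (length a + length b) ≤ f → suc (length a + length b) ≤ f′ →
         buildF f (a ++ M ∷ b) ≡ buildF f′ (a ++ M ∷ b)
    go (suc f) (suc f′) (s≤s ≤f) (s≤s ≤f′)
      rewrite buildF-++-∷ f a M b a< b< | buildF-++-∷ f′ a M b a< b< =
      cong₂ (λ x y → node x M y)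
        (buildF-fuel da f f′ (m+n≤o⇒m≤o (length a) ≤f) (m+n≤o⇒m≤o (length a) ≤f′))
        (buildF-fuel db f f′ (m+n≤o⇒n≤o (length a) ≤f) (m+n≤o⇒n≤o (length a) ≤f′))

  T-++-∷ : ∀ {a M b} → Distinct a → Distinct b → All (_< M) a → All (_< M) b → T (a ++ M ∷ b) ≡ node (T a) M (T b)
  T-++-∷ {a} {M} {b} da db a< b< rewrite length-++-∷ a M b | buildF-++-∷ (length a + length b) a M b a< b< =
    cong₂ (λ x y → node x M y) (buildF-fuel da _ _ (m≤m+n (length a) (length b)) ≤-refl)
                               (buildF-fuel db _ _ (m≤n+m (length b) (length a)) ≤-refl)

  size-T : ∀ {p} → Distinct p → size (T p) ≡ length p
  size-T [] = refl
  size-T (atMax {a} {M} {b} da db a< b<) rewrite T-++-∷ da db a< b< | size-T da | size-T db = sym (length-++-∷ a M b)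

  module _ {A : Set} where

    take-++-≤ : ∀ i (a ys : List A) → i ≤ length a → take i (a ++ ys) ≡ take i a
    take-++-≤ zero    a       ys _         = refl
    take-++-≤ (suc i) (x ∷ a) ys (s≤s i≤) = cong (x ∷_) (take-++-≤ i a ys i≤)

    drop-++-≤ : ∀ i (a ys : List A) → i ≤ length a → drop i (a ++ ys) ≡ drop i a ++ ys
    drop-++-≤ zero    a       ys _         = refl
    drop-++-≤ (suc i) (x ∷ a) ys (s≤s i≤) = drop-++-≤ i a ys i≤

    take-++-+ : ∀ (a ys : List A) k → take (length a + k) (a ++ ys) ≡ a ++ take k ys
    take-++-+ []      ys k = refl
    take-++-+ (x ∷ a) ys k = cong (x ∷_) (take-++-+ a ys k)

    drop-++-+ : ∀ (a ys : List A) k → drop (length a + k) (a ++ ys) ≡ drop k ys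
    drop-++-+ []      ys k = refl
    drop-++-+ (x ∷ a) ys k = drop-++-+ a ys k

  ≰⇒≡+suc : ∀ {i n} → ¬ i ≤ n → i ≡ n + suc (i ∸ suc n)
  ≰⇒≡+suc {i} {n} i≰ = trans (sym (m+[n∸m]≡n (≰⇒> i≰))) (sym (+-suc n (i ∸ suc n)))

  m+[1+n]∸[1+m]≡n : ∀ m n → m + suc n ∸ suc m ≡ n
  m+[1+n]∸[1+m]≡n zero    n = refl
  m+[1+n]∸[1+m]≡n (suc m) n = m+[1+n]∸[1+m]≡n m n

  Distinct-take-drop : ∀ {p} → Distinct p → ∀ i → Distinct (take i p) × Distinct (drop i p)
  Distinct-take-drop []      zero    = [] , []
  Distinct-take-drop []      (suc i) = [] , []
  Distinct-take-drop (atMax {a} {M} {b} da db a< b<) i with i ≤? length a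
  ... | yes i≤ rewrite take-++-≤ i a (M ∷ b) i≤ | drop-++-≤ i a (M ∷ b) i≤ =
    proj₁ (Distinct-take-drop da i) , atMax (proj₂ (Distinct-take-drop da i)) db (drop⁺ i a<) b<
  ... | no i≰ rewrite ≰⇒≡+suc i≰ | take-++-+ a (M ∷ b) (suc (i ∸ suc (length a)))
                    | drop-++-+ a (M ∷ b) (suc (i ∸ suc (length a))) =
    atMax da (proj₁ (Distinct-take-drop db j)) a< (take⁺ j b<) , proj₂ (Distinct-take-drop db j)
    where j = i ∸ suc (length a)

  splitAt-T : ∀ {p} → Distinct p → ∀ i → splitAt i (T p) ≡ (T (take i p) , T (drop i p))
  splitAt-T []      zero    = refl
  splitAt-T []      (suc i) = refl
  splitAt-T (atMax {a} {M} {b} da db a< b<) i rewrite T-++-∷ da db a< b< with i ≤? length a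
  ... | yes i≤ rewrite splitAt-≤ {i} {T a} {M} {T b} (subst (i ≤_) (sym (size-T da)) i≤)
                     | take-++-≤ i a (M ∷ b) i≤ | drop-++-≤ i a (M ∷ b) i≤ | splitAt-T da i
                     | T-++-∷ (proj₂ (Distinct-take-drop da i)) db (drop⁺ i a<) b< = refl
  ... | no i≰ = right i (i ∸ suc (length a)) (≰⇒≡+suc i≰) i≰
    where
    right : ∀ i j → i ≡ length a + suc j → ¬ i ≤ length a →
            splitAt i (node (T a) M (T b)) ≡ (T (take i (a ++ M ∷ b)) , T (drop i (a ++ M ∷ b)))
    right .(length a + suc j) j refl i≰
      rewrite splitAt-≰ {length a + suc j} {T a} {M} {T b} (subst (λ z → ¬ length a + suc j ≤ z) (sym (size-T da)) i≰)
            | size-T da | m+[1+n]∸[1+m]≡n (length a) j | splitAt-T db j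
            | take-++-+ a (M ∷ b) (suc j) | drop-++-+ a (M ∷ b) (suc j)
            | T-++-∷ da (proj₁ (Distinct-take-drop db j)) a< (take⁺ j b<) = refl

  IsPermutation : ℕ → List ℕ → Set
  IsPermutation n p = Distinct p × All (_< suc n) p × length p ≡ n

  length-take-drop : ∀ i (p : List ℕ) → length (take i p) + length (drop i p) ≡ length p
  length-take-drop i p = trans (sym (length-++ (take i p))) (cong length (take++drop≡id i p))

  insertAt-IsPermutation : ∀ {n p} i → IsPermutation n p → IsPermutation (suc n) (insertAt (suc n) p i)
  insertAt-IsPermutation {n} {p} i (dp , p< , len) =
    atMax (proj₁ (Distinct-take-drop dp i)) (proj₂ (Distinct-take-drop dp i)) (take⁺ i p<) (drop⁺ i p<) ,
    ++⁺ (take⁺ i p≤) (n<1+n (suc n) ∷ drop⁺ i p≤) ,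
    trans (length-++-∷ (take i p) (suc n) (drop i p)) (cong suc (trans (length-take-drop i p) len))
    where p≤ = All.map m<n⇒m<1+n p<

  perms-IsPermutation : ∀ n → All (IsPermutation n) (perms n)
  perms-IsPermutation zero    = ([] , [] , refl) ∷ []
  perms-IsPermutation (suc n) = concat⁺ (map⁺ (All.map inserts (perms-IsPermutation n)))
    where
    inserts : ∀ {p} → IsPermutation n p → All (IsPermutation (suc n)) (insertEverywhere (suc n) p)
    inserts {p} πp = subst (All (IsPermutation (suc n))) (sym (insertEverywhere≡map-insertAt (suc n) p))
                           (map⁺ (All.universal (λ i → insertAt-IsPermutation i πp) _))

  shapes : ℕ → List Tree
  shapes n = map (shape ∘ T) (perms n)

  grow : ℕ → Tree → List Tree
  grow n t = map (λ m → join (splitAt m t)) (range (suc n))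

  shape-T-insertAt : ∀ {n p} i → IsPermutation n p → shape (T (insertAt (suc n) p i)) ≡ join (splitAt i (shape (T p)))
  shape-T-insertAt {p = p} i (dp , p< , _)
    rewrite T-++-∷ (proj₁ (Distinct-take-drop dp i)) (proj₂ (Distinct-take-drop dp i)) (take⁺ i p<) (drop⁺ i p<)
          | splitAt-shape i (T p) | splitAt-T dp i = refl

  shapes-suc : ∀ n → shapes (suc n) ≡ concatMap (grow n) (shapes n)
  shapes-suc n = begin
    map (shape ∘ T) (concatMap (insertEverywhere (suc n)) (perms n))
      ≡⟨ map-concatMap (shape ∘ T) _ (perms n) ⟩
    concatMap (λ p → map (shape ∘ T) (insertEverywhere (suc n) p)) (perms n)
      ≡⟨ concatMap-cong-All (perms-IsPermutation n) grows ⟩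
    concatMap (λ p → grow n (shape (T p))) (perms n)
      ≡⟨ concatMap-map (grow n) (shape ∘ T) (perms n) ⟨
    concatMap (grow n) (shapes n) ∎
    where
    concatMap-cong-All : ∀ {A B : Set} {P : A → Set} {f g : A → List B} {xs} →
                         All P xs → (∀ {x} → P x → f x ≡ g x) → concatMap f xs ≡ concatMap g xs
    concatMap-cong-All []       _ = refl
    concatMap-cong-All (p ∷ ps) h = cong₂ _++_ (h p) (concatMap-cong-All ps h)
    grows : ∀ {p} → IsPermutation n p → map (shape ∘ T) (insertEverywhere (suc n) p) ≡ grow n (shape (T p))
    grows {p} πp@(_ , _ , len) rewrite insertEverywhere≡map-insertAt (suc n) p = begin
      map (shape ∘ T) (map (insertAt (suc n) p) (range (suc (length p))))
        ≡⟨ cong (λ z → map (shape ∘ T) (map (insertAt (suc n) p) (range (suc z)))) len ⟩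
      map (shape ∘ T) (map (insertAt (suc n) p) (range (suc n)))
        ≡⟨ map-∘ (range (suc n)) ⟨
      map (shape ∘ T ∘ insertAt (suc n) p) (range (suc n))
        ≡⟨ map-cong (λ i → shape-T-insertAt i πp) (range (suc n)) ⟩
      grow n (shape (T p)) ∎

module Splitting where

  open import Data.Nat using (ℕ; zero; suc; _+_; _*_; _∸_; _≤_; _!)
  open import Data.Nat.Properties
    using (*-comm; *-assoc; *-zeroʳ; *-distribˡ-+; *-distribʳ-+; suc-injective; +-suc; ≤-pred
          ; ≤-trans; m≤m+n; +-monoʳ-≤; <-irrefl; m+[n∸m]≡n)
  open import Data.Nat.Solver using (module +-*-Solver)
  open import Data.Product using (_,_; _,′_; proj₁; proj₂; uncurry)
  open import Data.List using (List; []; _∷_; _++_; map; concatMap; length)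
  open import Data.List.Properties using (length-map)
  open import Data.List.Relation.Unary.All as All using (All; []; _∷_)
  open import Data.List.Relation.Unary.All.Properties using (map⁺; concat⁺)
  open import Function using (_∘_)
  open import Relation.Nullary using (¬_)
  open import Relation.Binary.PropositionalEquality
  open ≡-Reasoning
  open +-*-Solver

  open import Defs
  open Shapes
  open Sums
  open Permutations

  size-join-splitAt : ∀ m t → size (join (splitAt m t)) ≡ suc (size t)
  size-join-splitAt m t = cong suc (size-splitAt m t)

  shapes-size : ∀ n → All (λ t → size t ≡ n) (shapes n)
  shapes-size zero    = refl ∷ []
  shapes-size (suc n) rewrite shapes-suc n =
    concat⁺ (map⁺ (All.map (λ {t} size≡ → map⁺ (All.universal (λ m → trans (size-join-splitAt m t) (cong suc size≡)) _))
                           (shapes-size n)))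

  length-shapes : ∀ n → length (shapes n) ≡ n !
  length-shapes zero    = refl
  length-shapes (suc n) rewrite shapes-suc n = begin
    length (concatMap (grow n) (shapes n))        ≡⟨ length-concatMap (grow n) (shapes n) ⟩
    ∑ (shapes n) (λ t → length (grow n t))        ≡⟨ ∑-cong (shapes n) (λ t → trans (length-map _ (range (suc n))) (length-range (suc n))) ⟩
    ∑ (shapes n) (λ _ → suc n)                    ≡⟨ ∑-const (shapes n) (suc n) ⟩
    length (shapes n) * suc n                     ≡⟨ cong (_* suc n) (length-shapes n) ⟩
    n ! * suc n                                   ≡⟨ *-comm (n !) (suc n) ⟩
    suc n !                                       ∎

  ∑-shapes-suc : ∀ n (f : Tree → ℕ) →
                 ∑ (shapes (suc n)) f ≡ ∑ (shapes n) (λ t → ∑ (range (suc n)) (λ m → f (join (splitAt m t))))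
  ∑-shapes-suc n f rewrite shapes-suc n =
    trans (∑-concatMap (grow n) (shapes n) f) (∑-cong (shapes n) (λ t → ∑-map _ (range (suc n)) f))

  ∑-range-+ : ∀ i j (f : ℕ → ℕ) → ∑ (range (i + j)) f ≡ ∑ (range i) f + ∑ (range j) (f ∘ (i +_))
  ∑-range-+ i j f = begin
    ∑ (range (i + j)) f                              ≡⟨ cong (λ r → ∑ r f) (range-+ i j) ⟩
    ∑ (range i ++ map (i +_) (range j)) f           ≡⟨ ∑-++ (range i) _ f ⟩
    ∑ (range i) f + ∑ (map (i +_) (range j)) f       ≡⟨ cong (∑ (range i) f +_) (∑-map (i +_) (range j) f) ⟩
    ∑ (range i) f + ∑ (range j) (f ∘ (i +_))         ∎

  splitAt-join-right : ∀ i m t → i + m ≤ size t →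
                       splitAt i (join (splitAt (i + m) t)) ≡ (takeT i t , join (splitAt m (dropT i t)))
  splitAt-join-right i m t i+m≤
    rewrite splitAt-≤ {i} {takeT (i + m) t} {0} {dropT (i + m) t}
              (subst (i ≤_) (sym (size-takeT (i + m) t i+m≤)) (m≤m+n i m))
    = cong₂ (λ p d → proj₁ p ,′ node (proj₂ p) 0 d) (proj₁ (splitAt-+ t i m)) (proj₂ (splitAt-+ t i m))

  splitAt-join-left : ∀ i m t → m ≤ i → i ≤ size t →
                      splitAt (suc i) (join (splitAt m t)) ≡ (join (splitAt m (takeT i t)) , dropT i t)
  splitAt-join-left i m t m≤i i≤
    rewrite splitAt-≰ {suc i} {takeT m t} {0} {dropT m t}
              (subst (λ z → ¬ suc i ≤ z) (sym (size-takeT m t (≤-trans m≤i i≤))) (λ i<m → <-irrefl refl (≤-trans i<m m≤i)))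
          | size-takeT m t (≤-trans m≤i i≤)
    = shift (i ∸ m) (m+[n∸m]≡n m≤i)
    where
    shift : ∀ k → m + k ≡ i → (node (takeT m t) 0 (takeT k (dropT m t)) ,′ dropT k (dropT m t))
                              ≡ (join (splitAt m (takeT i t)) , dropT i t)
    shift k refl = sym (cong₂ (λ p d → node (proj₁ p) 0 (proj₂ p) ,′ d) (proj₁ (splitAt-+ t m k)) (proj₂ (splitAt-+ t m k)))

  SplitsIndependently : ℕ → Set
  SplitsIndependently n = ∀ i j → i + j ≡ n → (h : Tree → Tree → ℕ) →
    i ! * j ! * ∑ (shapes n) (uncurry h ∘ splitAt i) ≡ n ! * ∑ (shapes i) (λ a → ∑ (shapes j) (h a))

  insertions-right-of-cut : ∀ n → SplitsIndependently n → ∀ i j → i + j ≡ suc n → (h : Tree → Tree → ℕ) →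
    i ! * j ! * ∑ (shapes n) (λ t → ∑ (range j) (λ m → uncurry h (splitAt i (join (splitAt (i + m) t)))))
    ≡ j * (n ! * ∑ (shapes i) (λ a → ∑ (shapes j) (h a)))
  insertions-right-of-cut n ih i zero _ h = trans (cong (i ! * 1 *_) (∑-zero (shapes n))) (*-zeroʳ (i ! * 1))
  insertions-right-of-cut n ih i (suc j′) i+j≡ h = begin
    i ! * (suc j′ * j′ !) * X
      ≡⟨ solve 4 (λ a b c x → a :* (b :* c) :* x := b :* (a :* c :* x)) refl (i !) (suc j′) (j′ !) X ⟩
    suc j′ * (i ! * j′ ! * X)
      ≡⟨ cong (λ z → suc j′ * (i ! * j′ ! * z)) X≡ ⟩
    suc j′ * (i ! * j′ ! * ∑ (shapes n) (uncurry H ∘ splitAt i))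
      ≡⟨ cong (suc j′ *_) (ih i j′ (suc-injective (trans (sym (+-suc i j′)) i+j≡)) H) ⟩
    suc j′ * (n ! * ∑ (shapes i) (λ a → ∑ (shapes j′) (H a)))
      ≡⟨ cong (λ z → suc j′ * (n ! * z)) (∑-cong (shapes i) (λ a → sym (∑-shapes-suc j′ (h a)))) ⟩
    suc j′ * (n ! * ∑ (shapes i) (λ a → ∑ (shapes (suc j′)) (h a))) ∎
    where
    X = ∑ (shapes n) (λ t → ∑ (range (suc j′)) (λ m → uncurry h (splitAt i (join (splitAt (i + m) t)))))
    H : Tree → Tree → ℕ
    H a c = ∑ (range (suc j′)) (λ m → h a (join (splitAt m c)))
    X≡ : X ≡ ∑ (shapes n) (uncurry H ∘ splitAt i)
    X≡ = ∑-cong-All (shapes-size n) λ {t} size≡ → ∑-cong-All (All-<-range (suc j′)) λ {m} m< →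
      cong (uncurry h) (splitAt-join-right i m t (subst (i + m ≤_) (sym size≡)
        (≤-pred (subst (suc (i + m) ≤_) i+j≡ (subst (_≤ i + suc j′) (+-suc i m) (+-monoʳ-≤ i m<))))))

  insertions-left-of-cut : ∀ n → SplitsIndependently n → ∀ i j → i + j ≡ suc n → (h : Tree → Tree → ℕ) →
    i ! * j ! * ∑ (shapes n) (λ t → ∑ (range i) (λ m → uncurry h (splitAt i (join (splitAt m t)))))
    ≡ i * (n ! * ∑ (shapes i) (λ a → ∑ (shapes j) (h a)))
  insertions-left-of-cut n ih zero j _ h = trans (cong (1 * j ! *_) (∑-zero (shapes n))) (*-zeroʳ (1 * j !))
  insertions-left-of-cut n ih (suc i′) j i+j≡ h = begin
    suc i′ * i′ ! * j ! * X
      ≡⟨ solve 4 (λ a b c x → b :* a :* c :* x := b :* (a :* c :* x)) refl (i′ !) (suc i′) (j !) X ⟩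
    suc i′ * (i′ ! * j ! * X)
      ≡⟨ cong (λ z → suc i′ * (i′ ! * j ! * z)) X≡ ⟩
    suc i′ * (i′ ! * j ! * ∑ (shapes n) (uncurry H ∘ splitAt i′))
      ≡⟨ cong (suc i′ *_) (ih i′ j i′+j≡n H) ⟩
    suc i′ * (n ! * ∑ (shapes i′) (λ c → ∑ (shapes j) (H c)))
      ≡⟨ cong (λ z → suc i′ * (n ! * z)) (∑-cong (shapes i′) (λ c → ∑-comm (shapes j) (range (suc i′)) _)) ⟩
    suc i′ * (n ! * ∑ (shapes i′) (λ c → ∑ (range (suc i′)) (λ m → ∑ (shapes j) (h (join (splitAt m c))))))
      ≡⟨ cong (λ z → suc i′ * (n ! * z)) (∑-shapes-suc i′ (λ a → ∑ (shapes j) (h a))) ⟨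
    suc i′ * (n ! * ∑ (shapes (suc i′)) (λ a → ∑ (shapes j) (h a))) ∎
    where
    i′+j≡n = suc-injective i+j≡
    X = ∑ (shapes n) (λ t → ∑ (range (suc i′)) (λ m → uncurry h (splitAt (suc i′) (join (splitAt m t)))))
    H : Tree → Tree → ℕ
    H c b = ∑ (range (suc i′)) (λ m → h (join (splitAt m c)) b)
    X≡ : X ≡ ∑ (shapes n) (uncurry H ∘ splitAt i′)
    X≡ = ∑-cong-All (shapes-size n) λ {t} size≡ → ∑-cong-All (All-<-range (suc i′)) λ {m} m< →
      cong (uncurry h) (splitAt-join-left i′ m t (≤-pred m<) (subst (i′ ≤_) (trans i′+j≡n (sym size≡)) (m≤m+n i′ j)))

  -- By induction on n: the maximum of a shape of size n + 1 lies either left or right of the cut.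
  splitsIndependently : ∀ n → SplitsIndependently n
  splitsIndependently zero zero zero refl h =
    solve 1 (λ x → con 1 :* con 1 :* (x :+ con 0) := con 1 :* ((x :+ con 0) :+ con 0)) refl (h nil nil)
  splitsIndependently (suc n) i j i+j≡ h = begin
    i ! * j ! * ∑ (shapes (suc n)) F
      ≡⟨ cong (i ! * j ! *_) (trans (∑-shapes-suc n F) (trans (∑-cong (shapes n) byCut) (∑-+ (shapes n) _ _))) ⟩
    i ! * j ! * (L + R)
      ≡⟨ *-distribˡ-+ (i ! * j !) L R ⟩
    i ! * j ! * L + i ! * j ! * R
      ≡⟨ cong₂ _+_ (insertions-left-of-cut n ih i j i+j≡ h) (insertions-right-of-cut n ih i j i+j≡ h) ⟩
    i * (n ! * S) + j * (n ! * S)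
      ≡⟨ *-distribʳ-+ (n ! * S) i j ⟨
    (i + j) * (n ! * S)
      ≡⟨ cong (_* (n ! * S)) i+j≡ ⟩
    suc n * (n ! * S)
      ≡⟨ *-assoc (suc n) (n !) S ⟨
    suc n ! * S ∎
    where
    ih = splitsIndependently n
    F = uncurry h ∘ splitAt i
    S = ∑ (shapes i) (λ a → ∑ (shapes j) (h a))
    L = ∑ (shapes n) (λ t → ∑ (range i) (λ m → F (join (splitAt m t))))
    R = ∑ (shapes n) (λ t → ∑ (range j) (λ m → F (join (splitAt (i + m) t))))
    byCut : ∀ t → ∑ (range (suc n)) (λ m → F (join (splitAt m t)))
                ≡ ∑ (range i) (λ m → F (join (splitAt m t))) + ∑ (range j) (λ m → F (join (splitAt (i + m) t)))
    byCut t = trans (cong (λ k → ∑ (range k) (λ m → F (join (splitAt m t)))) (sym i+j≡))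
                    (∑-range-+ i j (λ m → F (join (splitAt m t))))

module Fractions where

  open import Data.Nat as ℕ using (ℕ; suc; NonZero)
  open import Data.Nat.Properties as ℕ using (m*n≢0)
  open import Data.Nat.Solver using (module +-*-Solver)
  open import Data.Integer as ℤ using (+_)
  open import Data.Integer.Properties as ℤ using (pos-*; pos-+)
  open import Data.Integer.Base using (+≤+)
  open import Data.Rational using (ℚ; 0ℚ; 1ℚ; _/_; _+_; _*_; _≤_; toℚᵘ)
  open import Data.Rational.Properties
    using (toℚᵘ-injective; toℚᵘ-fromℚᵘ; toℚᵘ-homo-*; toℚᵘ-homo-+; *-distribʳ-+; 0/n≡0
          ; nonNegative⁻¹; normalize-nonNeg; toℚᵘ-cancel-≤)
  open import Data.Rational.Unnormalised as ℚᵘ using (ℚᵘ; mkℚᵘ; *≡*; _≃_)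
  open import Data.Rational.Unnormalised.Properties as ℚᵘ using (≃-trans; ≃-sym; *-cong; +-cong; ≤-respˡ-≃; ≤-respʳ-≃)
  open import Relation.Binary.PropositionalEquality
  open ≡-Reasoning

  open import Defs using (fromℕℚ)

  frac : ℕ → (d : ℕ) → .{{NonZero d}} → ℚ
  frac a d = + a / d

  private
    toℚᵘ-frac : ∀ a d → toℚᵘ (frac a (suc d)) ≃ mkℚᵘ (+ a) d
    toℚᵘ-frac a d = toℚᵘ-fromℚᵘ (mkℚᵘ (+ a) d)

    from-ℚᵘ : ∀ {p} a d → toℚᵘ p ≃ mkℚᵘ (+ a) d → p ≡ frac a (suc d)
    from-ℚᵘ a d p≃ = toℚᵘ-injective (≃-trans p≃ (≃-sym (toℚᵘ-frac a d)))

    pos-*-cong : ∀ a b c d → a ℕ.* b ≡ c ℕ.* d → + a ℤ.* + b ≡ + c ℤ.* + d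
    pos-*-cong a b c d eq = trans (sym (pos-* a b)) (trans (cong +_ eq) (pos-* c d))

  frac-cross : ∀ a d b e .{{_ : NonZero d}} .{{_ : NonZero e}} → a ℕ.* e ≡ b ℕ.* d → frac a d ≡ frac b e
  frac-cross a (suc d) b (suc e) eq =
    from-ℚᵘ b e (≃-trans (toℚᵘ-frac a d) (*≡* (pos-*-cong a (suc e) b (suc d) eq)))

  frac-* : ∀ a d b e .{{_ : NonZero d}} .{{_ : NonZero e}} →
           frac a d * frac b e ≡ frac (a ℕ.* b) (d ℕ.* e) {{m*n≢0 d e}}
  frac-* a (suc d) b (suc e) = from-ℚᵘ (a ℕ.* b) (e ℕ.+ d ℕ.* suc e)
    (≃-trans (toℚᵘ-homo-* (frac a (suc d)) (frac b (suc e)))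
    (≃-trans (*-cong (toℚᵘ-frac a d) (toℚᵘ-frac b e))
             (*≡* (cong (ℤ._* + suc (e ℕ.+ d ℕ.* suc e)) (sym (pos-* a b))))))

  private
    frac-+-frac : ∀ a d b e → frac a (suc d) + frac b (suc e)
                            ≡ frac (a ℕ.* suc e ℕ.+ b ℕ.* suc d) (suc d ℕ.* suc e)
    frac-+-frac a d b e = from-ℚᵘ (a ℕ.* suc e ℕ.+ b ℕ.* suc d) (e ℕ.+ d ℕ.* suc e)
      (≃-trans (toℚᵘ-homo-+ (frac a (suc d)) (frac b (suc e)))
      (≃-trans (+-cong (toℚᵘ-frac a d) (toℚᵘ-frac b e))
               (*≡* (cong (ℤ._* + suc (e ℕ.+ d ℕ.* suc e))
                          (sym (trans (pos-+ (a ℕ.* suc e) (b ℕ.* suc d))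
                                      (cong₂ ℤ._+_ (pos-* a (suc e)) (pos-* b (suc d)))))))))

  open +-*-Solver

  fromℕℚ-+ : ∀ a b → fromℕℚ (a ℕ.+ b) ≡ fromℕℚ a + fromℕℚ b
  fromℕℚ-+ a b = sym (trans (frac-+-frac a 0 b 0)
    (frac-cross (a ℕ.* 1 ℕ.+ b ℕ.* 1) 1 (a ℕ.+ b) 1 (solve 2 (λ a b → (a :* con 1 :+ b :* con 1) :* con 1 := (a :+ b) :* con 1) refl a b)))

  frac≡fromℕℚ*frac-1 : ∀ a d .{{_ : NonZero d}} → frac a d ≡ fromℕℚ a * frac 1 d
  frac≡fromℕℚ*frac-1 a d@(suc _) = sym (trans (frac-* a 1 1 d) (frac-cross (a ℕ.* 1) (1 ℕ.* d) a d
    (solve 2 (λ a d → a :* con 1 :* d := a :* (con 1 :* d)) refl a d)))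

  frac-1-* : ∀ c d .{{_ : NonZero c}} .{{_ : NonZero d}} → frac 1 (c ℕ.* d) {{m*n≢0 c d}} ≡ frac 1 c * frac 1 d
  frac-1-* c d = sym (frac-* 1 c 1 d)

  fromℕℚ*frac-1 : ∀ d .{{_ : NonZero d}} → fromℕℚ d * frac 1 d ≡ 1ℚ
  fromℕℚ*frac-1 d@(suc _) = trans (frac-* d 1 1 d) (frac-cross (d ℕ.* 1) (1 ℕ.* d) 1 1
    (solve 1 (λ d → d :* con 1 :* con 1 := con 1 :* (con 1 :* d)) refl d))

  frac-+ : ∀ a b d .{{_ : NonZero d}} → frac (a ℕ.+ b) d ≡ frac a d + frac b d
  frac-+ a b d = begin
    frac (a ℕ.+ b) d                          ≡⟨ frac≡fromℕℚ*frac-1 (a ℕ.+ b) d ⟩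
    fromℕℚ (a ℕ.+ b) * frac 1 d               ≡⟨ cong (_* frac 1 d) (fromℕℚ-+ a b) ⟩
    (fromℕℚ a + fromℕℚ b) * frac 1 d          ≡⟨ *-distribʳ-+ (frac 1 d) (fromℕℚ a) (fromℕℚ b) ⟩
    fromℕℚ a * frac 1 d + fromℕℚ b * frac 1 d ≡⟨ cong₂ _+_ (frac≡fromℕℚ*frac-1 a d) (frac≡fromℕℚ*frac-1 b d) ⟨
    frac a d + frac b d                       ∎

  frac-0 : ∀ d .{{_ : NonZero d}} → frac 0 d ≡ 0ℚ
  frac-0 (suc d) = 0/n≡0 (suc d)

  0≤frac : ∀ a d .{{_ : NonZero d}} → 0ℚ ≤ frac a d
  0≤frac a (suc d) = nonNegative⁻¹ (frac a (suc d)) {{normalize-nonNeg a (suc d)}}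

  frac-≤ : ∀ a d b e .{{_ : NonZero d}} .{{_ : NonZero e}} → a ℕ.* e ℕ.≤ b ℕ.* d → frac a d ≤ frac b e
  frac-≤ a (suc d) b (suc e) le = toℚᵘ-cancel-≤
    (≤-respʳ-≃ (≃-sym (toℚᵘ-frac b e)) (≤-respˡ-≃ (≃-sym (toℚᵘ-frac a d))
      (ℚᵘ.*≤* (subst₂ ℤ._≤_ (pos-* a (suc e)) (pos-* b (suc d)) (+≤+ le)))))

module SumTo where

  open import Data.Nat as ℕ using (ℕ; zero; suc; _∸_; _≤_; _<_; NonZero)
  open import Data.Nat.Properties as ℕ using (m<n⇒m<1+n; n<1+n; ≤-pred; m∸[m∸n]≡n)
  open import Data.Rational using (ℚ; 1ℚ; _+_; _*_)
  open import Data.Rational.Properties using (+-identityˡ; +-identityʳ; +-assoc; +-comm)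
  import Data.Rational.Solver
  open Data.Rational.Solver.+-*-Solver using (solve; _:+_; _:*_; _:=_; con)
  open import Data.List using (_++_; []; _∷_)
  open import Function using (_∘_)
  open import Relation.Binary.PropositionalEquality
  open ≡-Reasoning

  open import Defs using (sumTo; two)
  open Sums using (∑; ∑-++; range)
  open Fractions

  sumTo-cong-< : ∀ n {f g : ℕ → ℚ} → (∀ m → m < n → f m ≡ g m) → sumTo n f ≡ sumTo n g
  sumTo-cong-< zero    f≡g = refl
  sumTo-cong-< (suc n) f≡g = cong₂ _+_ (sumTo-cong-< n (λ m m< → f≡g m (m<n⇒m<1+n m<))) (f≡g n (n<1+n n))

  sumTo-cong : ∀ n {f g : ℕ → ℚ} → (∀ m → f m ≡ g m) → sumTo n f ≡ sumTo n g
  sumTo-cong n f≡g = sumTo-cong-< n (λ m _ → f≡g m)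

  sumTo-+ : ∀ n (f g : ℕ → ℚ) → sumTo n (λ i → f i + g i) ≡ sumTo n f + sumTo n g
  sumTo-+ zero    f g = refl
  sumTo-+ (suc n) f g rewrite sumTo-+ n f g =
    solve 4 (λ a b c d → (a :+ b) :+ (c :+ d) := (a :+ c) :+ (b :+ d)) refl (sumTo n f) (sumTo n g) (f n) (g n)

  sumTo-suc : ∀ n (f : ℕ → ℚ) → sumTo (suc n) f ≡ f 0 + sumTo n (f ∘ suc)
  sumTo-suc zero    f = trans (+-identityˡ (f 0)) (sym (+-identityʳ (f 0)))
  sumTo-suc (suc n) f rewrite sumTo-suc n f = +-assoc (f 0) (sumTo n (f ∘ suc)) (f (suc n))

  sumTo-reverse : ∀ n (f : ℕ → ℚ) → sumTo n f ≡ sumTo n (λ m → f (n ∸ suc m))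
  sumTo-reverse zero    f = refl
  sumTo-reverse (suc n) f = begin
    sumTo n f + f n                      ≡⟨ cong (_+ f n) (sumTo-reverse n f) ⟩
    sumTo n (λ m → f (n ∸ suc m)) + f n  ≡⟨ +-comm _ (f n) ⟩
    f n + sumTo n (λ m → f (n ∸ suc m))  ≡⟨ sumTo-suc n (λ m → f (suc n ∸ suc m)) ⟨
    sumTo (suc n) (λ m → f (suc n ∸ suc m)) ∎

  two*≡+ : ∀ x → two * x ≡ x + x
  two*≡+ x = trans (cong (_* x) (fromℕℚ-+ 1 1)) (solve 1 (λ x → (con 1ℚ :+ con 1ℚ) :* x := x :+ x) refl x)

  sumTo-symmetrize : ∀ n (f h : ℕ → ℚ) → (∀ m → m ≤ n → f m ≡ h (n ∸ m)) →
                     sumTo (suc n) (λ m → f m + h m) ≡ two * sumTo (suc n) h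
  sumTo-symmetrize n f h f≡h∘reflect = begin
    sumTo (suc n) (λ m → f m + h m)                   ≡⟨ sumTo-+ (suc n) f h ⟩
    sumTo (suc n) f + sumTo (suc n) h                 ≡⟨ cong (_+ sumTo (suc n) h) (sumTo-cong-< (suc n) (λ m m< → f≡h∘reflect m (≤-pred m<))) ⟩
    sumTo (suc n) (λ m → h (n ∸ m)) + sumTo (suc n) h ≡⟨ cong (_+ sumTo (suc n) h) (sumTo-reverse (suc n) (λ m → h (n ∸ m))) ⟩
    sumTo (suc n) (λ m → h (n ∸ (n ∸ m))) + sumTo (suc n) h
      ≡⟨ cong (_+ sumTo (suc n) h) (sumTo-cong-< (suc n) (λ m m< → cong h (m∸[m∸n]≡n (≤-pred m<)))) ⟩
    sumTo (suc n) h + sumTo (suc n) h                 ≡⟨ two*≡+ (sumTo (suc n) h) ⟨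
    two * sumTo (suc n) h                             ∎

  frac-∑-range : ∀ k (f : ℕ → ℕ) d .{{_ : NonZero d}} → frac (∑ (range k) f) d ≡ sumTo k (λ m → frac (f m) d)
  frac-∑-range zero    f d = frac-0 d
  frac-∑-range (suc k) f d = begin
    frac (∑ (range k ++ k ∷ []) f) d              ≡⟨ cong (λ z → frac z d) (∑-++ (range k) (k ∷ []) f) ⟩
    frac (∑ (range k) f ℕ.+ (f k ℕ.+ 0)) d        ≡⟨ frac-+ (∑ (range k) f) (f k ℕ.+ 0) d ⟩
    frac (∑ (range k) f) d + frac (f k ℕ.+ 0) d   ≡⟨ cong₂ _+_ (frac-∑-range k f d) (cong (λ z → frac z d) (ℕ.+-identityʳ (f k))) ⟩
    sumTo k (λ m → frac (f m) d) + frac (f k) d   ∎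

module Expectation where

  open import Data.Nat as ℕ using (ℕ; suc; _∸_; _≤_; _!)
  open import Data.Nat.Properties as ℕ using (_!≢0; _!*_!≢0; m+[n∸m]≡n; ≤-pred)
  open import Data.Nat.Solver using (module +-*-Solver)
  open import Data.Rational using (ℚ; 1ℚ; _+_; _*_)
  open import Data.Rational.Properties using (*-identityʳ)
  open import Function using (_∘_)
  open import Relation.Binary.PropositionalEquality
  open ≡-Reasoning

  open import Defs
  open Shapes
  open Sums
  open Permutations
  open Splitting
  open Fractions
  open SumTo

  Eₛ : ℕ → (Tree → ℕ) → ℚ
  Eₛ n f = frac (∑ (shapes n) f) (n !) {{n !≢0}}

  E≡Eₛ : ∀ n (f : Tree → ℕ) → (∀ t → f (shape t) ≡ f t) → E n f ≡ Eₛ n f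
  E≡Eₛ n f f-shape = cong (λ z → frac z (n !) {{n !≢0}})
    (sym (trans (∑-map (shape ∘ T) (perms n) f) (∑-cong (perms n) (λ p → f-shape (T p)))))

  Eₛ-cong : ∀ n {f g : Tree → ℕ} → (∀ t → f t ≡ g t) → Eₛ n f ≡ Eₛ n g
  Eₛ-cong n f≡g = cong (λ z → frac z (n !) {{n !≢0}}) (∑-cong (shapes n) f≡g)

  Eₛ-+ : ∀ n (f g : Tree → ℕ) → Eₛ n (λ t → f t ℕ.+ g t) ≡ Eₛ n f + Eₛ n g
  Eₛ-+ n f g = trans (cong (λ z → frac z (n !) {{n !≢0}}) (∑-+ (shapes n) f g))
                     (frac-+ (∑ (shapes n) f) (∑ (shapes n) g) (n !) {{n !≢0}})

  E₂ : ℕ → ℕ → (Tree → Tree → ℕ) → ℚ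
  E₂ i j h = frac (∑ (shapes i) (λ a → ∑ (shapes j) (h a))) (i ! ℕ.* j !) {{i !* j !≢0}}

  E₂-cong : ∀ i j {h h′ : Tree → Tree → ℕ} → (∀ a b → h a b ≡ h′ a b) → E₂ i j h ≡ E₂ i j h′
  E₂-cong i j h≡h′ = cong (λ z → frac z (i ! ℕ.* j !) {{i !* j !≢0}})
                          (∑-cong (shapes i) (λ a → ∑-cong (shapes j) (h≡h′ a)))

  E₂-* : ∀ i j (f g : Tree → ℕ) → E₂ i j (λ a b → f a ℕ.* g b) ≡ Eₛ i f * Eₛ j g
  E₂-* i j f g = begin
    E₂ i j (λ a b → f a ℕ.* g b)
      ≡⟨ cong (λ z → frac z (i ! ℕ.* j !) {{i !* j !≢0}}) ∑∑≡ ⟩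
    frac (∑ (shapes i) f ℕ.* ∑ (shapes j) g) (i ! ℕ.* j !) {{i !* j !≢0}}
      ≡⟨ frac-* (∑ (shapes i) f) (i !) (∑ (shapes j) g) (j !) {{i !≢0}} {{j !≢0}} ⟨
    Eₛ i f * Eₛ j g ∎
    where
    ∑∑≡ : ∑ (shapes i) (λ a → ∑ (shapes j) (λ b → f a ℕ.* g b)) ≡ ∑ (shapes i) f ℕ.* ∑ (shapes j) g
    ∑∑≡ = trans (∑-cong (shapes i) (λ a → ∑-*ˡ (shapes j) (f a) g)) (∑-*ʳ (shapes i) (∑ (shapes j) g) f)

  Eₛ-1 : ∀ n → Eₛ n (λ _ → 1) ≡ 1ℚ
  Eₛ-1 n = frac-cross (∑ (shapes n) (λ _ → 1)) (n !) 1 1 {{n !≢0}}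
    (trans (ℕ.*-identityʳ _) (trans (∑-const (shapes n) 1) (trans (ℕ.*-identityʳ _) (trans (length-shapes n) (sym (ℕ.*-identityˡ (n !)))))))

  E₂-ˡ : ∀ i j (f : Tree → ℕ) → E₂ i j (λ a _ → f a) ≡ Eₛ i f
  E₂-ˡ i j f = begin
    E₂ i j (λ a _ → f a)                  ≡⟨ E₂-cong i j (λ a _ → sym (ℕ.*-identityʳ (f a))) ⟩
    E₂ i j (λ a _ → f a ℕ.* 1)            ≡⟨ E₂-* i j f (λ _ → 1) ⟩
    Eₛ i f * Eₛ j (λ _ → 1)               ≡⟨ cong (Eₛ i f *_) (Eₛ-1 j) ⟩
    Eₛ i f * 1ℚ                           ≡⟨ *-identityʳ (Eₛ i f) ⟩
    Eₛ i f                                ∎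

  E₂-ʳ : ∀ i j (g : Tree → ℕ) → E₂ i j (λ _ b → g b) ≡ Eₛ j g
  E₂-ʳ i j g = begin
    E₂ i j (λ _ b → g b)                  ≡⟨ E₂-cong i j (λ _ b → sym (ℕ.*-identityˡ (g b))) ⟩
    E₂ i j (λ _ b → 1 ℕ.* g b)            ≡⟨ E₂-* i j (λ _ → 1) g ⟩
    Eₛ i (λ _ → 1) * Eₛ j g               ≡⟨ cong (_* Eₛ j g) (Eₛ-1 i) ⟩
    1ℚ * Eₛ j g                           ≡⟨ Data.Rational.Properties.*-identityˡ (Eₛ j g) ⟩
    Eₛ j g                                ∎

  E₂-+ : ∀ i j (h h′ : Tree → Tree → ℕ) → E₂ i j (λ a b → h a b ℕ.+ h′ a b) ≡ E₂ i j h + E₂ i j h′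
  E₂-+ i j h h′ = trans
    (cong (λ z → frac z (i ! ℕ.* j !) {{i !* j !≢0}})
          (trans (∑-cong (shapes i) (λ a → ∑-+ (shapes j) (h a) (h′ a))) (∑-+ (shapes i) S S′)))
    (frac-+ (∑ (shapes i) S) (∑ (shapes i) S′) (i ! ℕ.* j !) {{i !* j !≢0}})
    where
    S S′ : Tree → ℕ
    S a = ∑ (shapes j) (h a)
    S′ a = ∑ (shapes j) (h′ a)

  fromℕℚ-suc-*-frac-! : ∀ n y → fromℕℚ (suc n) * frac y (suc n !) {{suc n !≢0}} ≡ frac y (n !) {{n !≢0}}
  fromℕℚ-suc-*-frac-! n y = trans (frac-* (suc n) 1 y (suc n !) {{_}} {{suc n !≢0}})
    (frac-cross (suc n ℕ.* y) (1 ℕ.* suc n !) y (n !) {{ℕ.m*n≢0 1 (suc n !) {{_}} {{suc n !≢0}}}} {{n !≢0}}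
      (solve 3 (λ n y f → (con 1 :+ n) :* y :* f := y :* (con 1 :* ((con 1 :+ n) :* f))) refl n y (n !)))
    where open +-*-Solver

  root-decomposition : ∀ n (F : Tree → ℕ) →
    fromℕℚ (suc n) * Eₛ (suc n) F ≡ sumTo (suc n) (λ m → E₂ m (n ∸ m) (λ a b → F (node a 0 b)))
  root-decomposition n F = begin
    fromℕℚ (suc n) * Eₛ (suc n) F
      ≡⟨ fromℕℚ-suc-*-frac-! n (∑ (shapes (suc n)) F) ⟩
    frac (∑ (shapes (suc n)) F) (n !) {{n !≢0}}
      ≡⟨ cong (λ z → frac z (n !) {{n !≢0}}) byPosition ⟩
    frac (∑ (range (suc n)) W) (n !) {{n !≢0}}
      ≡⟨ frac-∑-range (suc n) W (n !) {{n !≢0}} ⟩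
    sumTo (suc n) (λ m → frac (W m) (n !) {{n !≢0}})
      ≡⟨ sumTo-cong-< (suc n) (λ m m< → split m (≤-pred m<)) ⟩
    sumTo (suc n) (λ m → E₂ m (n ∸ m) h) ∎
    where
    h : Tree → Tree → ℕ
    h a b = F (node a 0 b)
    W : ℕ → ℕ
    W m = ∑ (shapes n) (λ t → F (join (splitAt m t)))
    byPosition : ∑ (shapes (suc n)) F ≡ ∑ (range (suc n)) W
    byPosition = trans (∑-shapes-suc n F) (∑-comm (shapes n) (range (suc n)) (λ t m → F (join (splitAt m t))))
    split : ∀ m → m ≤ n → frac (W m) (n !) {{n !≢0}} ≡ E₂ m (n ∸ m) h
    split m m≤n = frac-cross (W m) (n !) (∑ (shapes m) (λ a → ∑ (shapes (n ∸ m)) (h a))) (m ! ℕ.* (n ∸ m) !) {{n !≢0}} {{m !* (n ∸ m) !≢0}}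
      (trans (ℕ.*-comm (W m) _) (trans (splitsIndependently n m (n ∸ m) (m+[n∸m]≡n m≤n) h) (ℕ.*-comm (n !) _)))

module Recurrences where

  open import Data.Bool using (true; false; if_then_else_)
  open import Data.Nat as ℕ using (ℕ; zero; suc; _∸_; _≤_; _<_; _≟_; _≤?_; _⊓_; _!; z≤n; s≤s)
  open import Data.Nat.Properties as ℕ
    using (_!≢0; +-identityʳ; *-identityʳ; *-identityˡ; *-zeroʳ; <-≤-trans; m⊓n≤m; m⊓n≤n; ≤∧≢⇒<
          ; m≤n⇒m⊓n≡m; ⊓-comm; *-comm; m∸[m∸n]≡n)
  open import Data.Rational using (ℚ; 0ℚ; _+_; _*_)
  open import Data.Rational.Properties as ℚ using ()
  open import Relation.Nullary using (¬_; does; yes; no)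
  open import Relation.Nullary.Decidable using (dec-true; dec-false)
  open import Relation.Binary.PropositionalEquality
  open ≡-Reasoning

  open import Defs
  open Shapes
  open Sums
  open Permutations using (shapes)
  open Splitting using (shapes-size)
  open Fractions
  open SumTo
  open Expectation

  subtreePairs : ℕ → Tree → ℕ
  subtreePairs k nil          = 0
  subtreePairs k (node l _ r) = pairs k l ℕ.+ pairs k r

  rootPairs-nil : ∀ k → rootPairs k nil ≡ 0
  rootPairs-nil zero    = refl
  rootPairs-nil (suc k) = refl

  pairs≡root+subtrees : ∀ k t → pairs k t ≡ rootPairs k t ℕ.+ subtreePairs k t
  pairs≡root+subtrees k nil          = sym (trans (+-identityʳ _) (rootPairs-nil k))
  pairs≡root+subtrees k (node l v r) = ℕ.+-assoc (rootPairs k (node l v r)) (pairs k l) (pairs k r)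

  leavesAt-<rank : ∀ d t → d < rank t → leavesAt d t ≡ 0
  leavesAt-<rank d       nil                                   _         = refl
  leavesAt-<rank d       (node nil _ nil)                      ()
  leavesAt-<rank zero    (node (node _ _ _) _ nil)             _         = refl
  leavesAt-<rank (suc d) (node l@(node _ _ _) _ nil)           (s≤s d<)  = trans (+-identityʳ _) (leavesAt-<rank d l d<)
  leavesAt-<rank zero    (node nil _ (node _ _ _))             _         = refl
  leavesAt-<rank (suc d) (node nil _ r@(node _ _ _))           (s≤s d<)  = leavesAt-<rank d r d<
  leavesAt-<rank zero    (node (node _ _ _) _ (node _ _ _))    _         = refl
  leavesAt-<rank (suc d) (node l@(node _ _ _) _ r@(node _ _ _)) (s≤s d<) =
    cong₂ ℕ._+_ (leavesAt-<rank d l (<-≤-trans d< (m⊓n≤m _ _))) (leavesAt-<rank d r (<-≤-trans d< (m⊓n≤n _ _)))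

  rootPairs-≢ : ∀ k t → ¬ rank t ≡ k → rootPairs k t ≡ 0
  rootPairs-≢ k t r≢k = cong (λ b → if b then closestLeaves t else 0) (dec-false (rank t ≟ k) r≢k)

  rootPairs-≤rank : ∀ k t → k ≤ rank t → rootPairs k t ≡ leavesAt k t
  rootPairs-≤rank k t k≤r with rank t ≟ k
  ... | yes r≡k = trans (cong (λ b → if b then closestLeaves t else 0) (dec-true (rank t ≟ k) r≡k))
                        (cong (λ d → leavesAt d t) r≡k)
  ... | no r≢k  = trans (rootPairs-≢ k t r≢k) (sym (leavesAt-<rank k t (≤∧≢⇒< k≤r (λ k≡r → r≢k (sym k≡r)))))

  rank≥ : ℕ → Tree → ℕ
  rank≥ k t = if does (k ≤? rank t) then 1 else 0

  -- The empty tree is counted as having every rank: it is the term 1 of 1 + B_{≥k}.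
  emptyOrRank≥ : ℕ → Tree → ℕ
  emptyOrRank≥ k nil            = 1
  emptyOrRank≥ k t@(node _ _ _) = rank≥ k t

  rootPairs-*-rank≥ : ∀ k a b → ¬ rank a ⊓ rank b ≡ k → rootPairs k a ℕ.* rank≥ k b ≡ 0
  rootPairs-*-rank≥ k a b ⊓≢k with rank a ≟ k
  ... | no ra≢k = cong (ℕ._* rank≥ k b) (rootPairs-≢ k a ra≢k)
  ... | yes refl = trans (cong (λ x → rootPairs (rank a) a ℕ.* (if x then 1 else 0))
                               (dec-false (rank a ≤? rank b) (λ ra≤rb → ⊓≢k (m≤n⇒m⊓n≡m ra≤rb))))
                         (*-zeroʳ (rootPairs (rank a) a))

  rootPairs-join-nodes : ∀ k a b →
    (if does (rank a ⊓ rank b ≟ k) then leavesAt (rank a ⊓ rank b) a ℕ.+ leavesAt (rank a ⊓ rank b) b else 0)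
    ≡ rootPairs k a ℕ.* rank≥ k b ℕ.+ rank≥ k a ℕ.* rootPairs k b
  rootPairs-join-nodes k a b with rank a ⊓ rank b ≟ k
  ... | yes ⊓≡k = begin
    (if does (rank a ⊓ rank b ≟ k) then leaves (rank a ⊓ rank b) else 0)
      ≡⟨ cong (λ x → if x then leaves (rank a ⊓ rank b) else 0) (dec-true (rank a ⊓ rank b ≟ k) ⊓≡k) ⟩
    leaves (rank a ⊓ rank b)
      ≡⟨ cong leaves ⊓≡k ⟩
    leavesAt k a ℕ.+ leavesAt k b
      ≡⟨ cong₂ ℕ._+_ (rootPairs-≤rank k a k≤ra) (rootPairs-≤rank k b k≤rb) ⟨
    rootPairs k a ℕ.+ rootPairs k b
      ≡⟨ cong₂ ℕ._+_ (*-identityʳ (rootPairs k a)) (*-identityˡ (rootPairs k b)) ⟨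
    rootPairs k a ℕ.* 1 ℕ.+ 1 ℕ.* rootPairs k b
      ≡⟨ cong₂ (λ x y → rootPairs k a ℕ.* (if x then 1 else 0) ℕ.+ (if y then 1 else 0) ℕ.* rootPairs k b)
               (dec-true (k ≤? rank b) k≤rb) (dec-true (k ≤? rank a) k≤ra) ⟨
    rootPairs k a ℕ.* rank≥ k b ℕ.+ rank≥ k a ℕ.* rootPairs k b ∎
    where
    leaves : ℕ → ℕ
    leaves d = leavesAt d a ℕ.+ leavesAt d b
    k≤ra = subst (_≤ rank a) ⊓≡k (m⊓n≤m _ _)
    k≤rb = subst (_≤ rank b) ⊓≡k (m⊓n≤n _ _)
  ... | no ⊓≢k = trans
    (cong (λ x → if x then leavesAt (rank a ⊓ rank b) a ℕ.+ leavesAt (rank a ⊓ rank b) b else 0)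
          (dec-false (rank a ⊓ rank b ≟ k) ⊓≢k))
    (sym (cong₂ ℕ._+_
      (rootPairs-*-rank≥ k a b ⊓≢k)
      (trans (*-comm (rank≥ k a) _) (rootPairs-*-rank≥ k b a (λ e → ⊓≢k (trans (⊓-comm _ _) e))))))

  -- The root has rank k + 1 iff one child has rank k and the other is empty or has rank ≥ k;
  -- its closest leaves are then those of the children of rank k.
  rootPairs-join : ∀ k a b → rootPairs (suc k) (node a 0 b)
                           ≡ rootPairs k a ℕ.* emptyOrRank≥ k b ℕ.+ emptyOrRank≥ k a ℕ.* rootPairs k b
  rootPairs-join k nil            nil            rewrite rootPairs-nil k = refl
  rootPairs-join k nil            b@(node _ _ _) rewrite rootPairs-nil k = sym (+-identityʳ _)
  rootPairs-join k a@(node _ _ _) nil            rewrite rootPairs-nil k =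
    onlyLeft (does (rank a ≟ k)) (leavesAt (rank a) a) (rank≥ k a)
    where
    onlyLeft : ∀ c x y → (if c then x ℕ.+ 0 else 0) ≡ (if c then x else 0) ℕ.* 1 ℕ.+ y ℕ.* 0
    onlyLeft true  x y = sym (cong₂ ℕ._+_ (*-identityʳ x) (*-zeroʳ y))
    onlyLeft false x y = sym (*-zeroʳ y)
  rootPairs-join k a@(node _ _ _) b@(node _ _ _) = rootPairs-join-nodes k a b

  G≡Eₛ : ∀ n k → G n k ≡ Eₛ n (pairs k)
  G≡Eₛ n k = E≡Eₛ n (pairs k) (pairs-shape k)

  g≡Eₛ : ∀ n k → g n k ≡ Eₛ n (rootPairs k)
  g≡Eₛ n k = E≡Eₛ n (rootPairs k) (rootPairs-shape k)

  Ahat≡G : ∀ k m → Ahat k m ≡ G m k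
  Ahat≡G k zero    = refl
  Ahat≡G k (suc m) = refl

  Bhat≡g : ∀ k m → Bhat k m ≡ g m k
  Bhat≡g zero    zero    = refl
  Bhat≡g (suc k) zero    = refl
  Bhat≡g k       (suc m) = refl

  Ahat-recurrence : ∀ k n → deriv (Ahat k) n ≡ (scale two (geom ⊗ Ahat k) ⊕ deriv (Bhat k)) n
  Ahat-recurrence k n = begin
    N * G (suc n) k
      ≡⟨ cong (N *_) (trans (G≡Eₛ (suc n) k) (Eₛ-cong (suc n) (pairs≡root+subtrees k))) ⟩
    N * Eₛ (suc n) (λ t → rootPairs k t ℕ.+ subtreePairs k t)
      ≡⟨ trans (cong (N *_) (Eₛ-+ (suc n) (rootPairs k) (subtreePairs k))) (ℚ.*-distribˡ-+ N _ _) ⟩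
    N * Eₛ (suc n) (rootPairs k) + N * Eₛ (suc n) (subtreePairs k)
      ≡⟨ cong₂ _+_ (cong (N *_) (sym (g≡Eₛ (suc n) k))) (root-decomposition n (subtreePairs k)) ⟩
    N * g (suc n) k + sumTo (suc n) (λ m → E₂ m (n ∸ m) (λ a b → pairs k a ℕ.+ pairs k b))
      ≡⟨ cong (N * g (suc n) k +_) (sumTo-cong (suc n) subtrees) ⟩
    N * g (suc n) k + sumTo (suc n) (λ m → G m k + geom m * Ahat k (n ∸ m))
      ≡⟨ cong (N * g (suc n) k +_) (sumTo-symmetrize n (λ m → G m k) (λ m → geom m * Ahat k (n ∸ m)) reflect) ⟩
    N * g (suc n) k + two * sumTo (suc n) (λ m → geom m * Ahat k (n ∸ m))
      ≡⟨ ℚ.+-comm (N * g (suc n) k) _ ⟩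
    two * sumTo (suc n) (λ m → geom m * Ahat k (n ∸ m)) + N * g (suc n) k ∎
    where
    N = fromℕℚ (suc n)
    G≡geom*Ahat : ∀ i m → G m k ≡ geom i * Ahat k m
    G≡geom*Ahat i m = sym (trans (ℚ.*-identityˡ _) (Ahat≡G k m))
    subtrees : ∀ m → E₂ m (n ∸ m) (λ a b → pairs k a ℕ.+ pairs k b) ≡ G m k + geom m * Ahat k (n ∸ m)
    subtrees m = begin
      E₂ m (n ∸ m) (λ a b → pairs k a ℕ.+ pairs k b)
        ≡⟨ E₂-+ m (n ∸ m) (λ a _ → pairs k a) (λ _ b → pairs k b) ⟩
      E₂ m (n ∸ m) (λ a _ → pairs k a) + E₂ m (n ∸ m) (λ _ b → pairs k b)
        ≡⟨ cong₂ _+_ (E₂-ˡ m (n ∸ m) (pairs k)) (E₂-ʳ m (n ∸ m) (pairs k)) ⟩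
      Eₛ m (pairs k) + Eₛ (n ∸ m) (pairs k)
        ≡⟨ cong₂ _+_ (G≡Eₛ m k) (trans (sym (G≡geom*Ahat m (n ∸ m))) (G≡Eₛ (n ∸ m) k)) ⟨
      G m k + geom m * Ahat k (n ∸ m) ∎
    reflect : ∀ m → m ≤ n → G m k ≡ geom (n ∸ m) * Ahat k (n ∸ (n ∸ m))
    reflect m m≤n = trans (G≡geom*Ahat (n ∸ m) m) (cong (λ i → geom (n ∸ m) * Ahat k i) (sym (m∸[m∸n]≡n m≤n)))

  Eₛ-emptyOrRank≥ : ∀ k n → Eₛ n (emptyOrRank≥ k) ≡ (oneS ⊕ Bge k) n
  Eₛ-emptyOrRank≥ k zero    = refl
  Eₛ-emptyOrRank≥ k (suc n) = begin
    Eₛ (suc n) (emptyOrRank≥ k) ≡⟨ cong (λ z → frac z (suc n !) {{suc n !≢0}}) (∑-cong-All (shapes-size (suc n)) nonEmpty) ⟩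
    Eₛ (suc n) (rank≥ k)        ≡⟨ E≡Eₛ (suc n) (rank≥ k) (λ t → cong (λ r → if does (k ≤? r) then 1 else 0) (rank-shape t)) ⟨
    Pge (suc n) k               ≡⟨ ℚ.+-identityˡ _ ⟨
    0ℚ + Pge (suc n) k          ∎
    where
    nonEmpty : ∀ {t} → size t ≡ suc n → emptyOrRank≥ k t ≡ rank≥ k t
    nonEmpty {node _ _ _} _ = refl

  Bhat-recurrence : ∀ k n → deriv (Bhat (suc k)) n ≡ scale two ((oneS ⊕ Bge k) ⊗ Bhat k) n
  Bhat-recurrence k n = begin
    fromℕℚ (suc n) * g (suc n) (suc k)
      ≡⟨ cong (fromℕℚ (suc n) *_) (g≡Eₛ (suc n) (suc k)) ⟩
    fromℕℚ (suc n) * Eₛ (suc n) (rootPairs (suc k))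
      ≡⟨ root-decomposition n (rootPairs (suc k)) ⟩
    sumTo (suc n) (λ m → E₂ m (n ∸ m) (λ a b → rootPairs (suc k) (node a 0 b)))
      ≡⟨ sumTo-cong (suc n) atRoot ⟩
    sumTo (suc n) (λ m → g m k * C (n ∸ m) + C m * Bhat k (n ∸ m))
      ≡⟨ sumTo-symmetrize n (λ m → g m k * C (n ∸ m)) (λ m → C m * Bhat k (n ∸ m)) reflect ⟩
    two * sumTo (suc n) (λ m → C m * Bhat k (n ∸ m)) ∎
    where
    C = oneS ⊕ Bge k
    e = emptyOrRank≥ k
    atRoot : ∀ m → E₂ m (n ∸ m) (λ a b → rootPairs (suc k) (node a 0 b)) ≡ g m k * C (n ∸ m) + C m * Bhat k (n ∸ m)
    atRoot m = begin
      E₂ m (n ∸ m) (λ a b → rootPairs (suc k) (node a 0 b))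
        ≡⟨ E₂-cong m (n ∸ m) (rootPairs-join k) ⟩
      E₂ m (n ∸ m) (λ a b → rootPairs k a ℕ.* e b ℕ.+ e a ℕ.* rootPairs k b)
        ≡⟨ E₂-+ m (n ∸ m) _ _ ⟩
      E₂ m (n ∸ m) (λ a b → rootPairs k a ℕ.* e b) + E₂ m (n ∸ m) (λ a b → e a ℕ.* rootPairs k b)
        ≡⟨ cong₂ _+_ (E₂-* m (n ∸ m) (rootPairs k) e) (E₂-* m (n ∸ m) e (rootPairs k)) ⟩
      Eₛ m (rootPairs k) * Eₛ (n ∸ m) e + Eₛ m e * Eₛ (n ∸ m) (rootPairs k)
        ≡⟨ cong₂ _+_ (cong₂ _*_ (sym (g≡Eₛ m k)) (Eₛ-emptyOrRank≥ k (n ∸ m)))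
                     (cong₂ _*_ (Eₛ-emptyOrRank≥ k m) (sym (trans (Bhat≡g k (n ∸ m)) (g≡Eₛ (n ∸ m) k)))) ⟩
      g m k * C (n ∸ m) + C m * Bhat k (n ∸ m) ∎
    reflect : ∀ m → m ≤ n → g m k * C (n ∸ m) ≡ C (n ∸ m) * Bhat k (n ∸ (n ∸ m))
    reflect m m≤n = trans (ℚ.*-comm (g m k) (C (n ∸ m))) (cong (C (n ∸ m) *_)
                          (trans (sym (Bhat≡g k m)) (cong (Bhat k) (sym (m∸[m∸n]≡n m≤n)))))

  rank≢0 : ∀ t → 2 ≤ size t → ¬ rank t ≡ 0
  rank≢0 (node nil _ nil)                   (s≤s ())
  rank≢0 (node (node _ _ _) _ nil)          _ ()
  rank≢0 (node nil _ (node _ _ _))          _ ()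
  rank≢0 (node (node _ _ _) _ (node _ _ _)) _ ()

  Bhat-base : ∀ n → Bhat 0 n ≡ xS n
  Bhat-base zero          = refl
  Bhat-base (suc zero)    = refl
  Bhat-base (suc (suc n)) = begin
    g (2 ℕ.+ n) 0                                ≡⟨ g≡Eₛ (2 ℕ.+ n) 0 ⟩
    Eₛ (2 ℕ.+ n) (rootPairs 0)                   ≡⟨ cong (λ z → frac z ((2 ℕ.+ n) !) {{(2 ℕ.+ n) !≢0}}) noRank0 ⟩
    frac 0 ((2 ℕ.+ n) !) {{(2 ℕ.+ n) !≢0}}       ≡⟨ frac-0 ((2 ℕ.+ n) !) {{(2 ℕ.+ n) !≢0}} ⟩
    0ℚ                                           ∎
    where
    noRank0 : ∑ (shapes (2 ℕ.+ n)) (rootPairs 0) ≡ 0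
    noRank0 = trans (∑-cong-All (shapes-size (2 ℕ.+ n)) (λ {t} size≡ →
                       rootPairs-≢ 0 t (rank≢0 t (subst (2 ≤_) (sym size≡) (s≤s (s≤s z≤n))))))
                    (∑-zero (shapes (2 ℕ.+ n)))

module ClosedForm where

  open import Data.Nat as ℕ using (ℕ; zero; suc; _∸_)
  open import Data.Rational using (ℚ; 0ℚ; 1ℚ; _+_; _*_; _-_)
  open import Data.Rational.Properties using (*-identityˡ; *-identityʳ; *-zeroʳ; +-identityˡ; *-distribʳ-+)
  import Data.Rational.Solver
  open Data.Rational.Solver.+-*-Solver using (solve; _:+_; _:*_; _:-_; _:=_; con)
  open import Relation.Binary.PropositionalEquality
  open ≡-Reasoning

  open import Defs
  open Fractions
  open SumTo
  open Recurrences

  weight : ℕ → ℚ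
  weight m = frac 1 (suc m ℕ.* suc (suc m))

  I : ℕ → ℕ → ℚ
  I k = intOneMinusX (Bhat k)

  I-suc : ∀ k n → I k (suc n) ≡ I k n + g n k * weight n
  I-suc k n = cong (λ z → I k n + z * weight n) (Bhat≡g k n)

  fromℕℚ-*-cancelˡ : ∀ n {x y} → fromℕℚ (suc n) * x ≡ fromℕℚ (suc n) * y → x ≡ y
  fromℕℚ-*-cancelˡ n {x} {y} eq = begin
    x             ≡⟨ *-identityˡ x ⟨
    1ℚ * x        ≡⟨ cong (_* x) (fromℕℚ*frac-1 (suc n)) ⟨
    N * r * x     ≡⟨ solve 3 (λ a b x → a :* b :* x := b :* (a :* x)) refl N r x ⟩
    r * (N * x)   ≡⟨ cong (r *_) eq ⟩
    r * (N * y)   ≡⟨ solve 3 (λ a b x → b :* (a :* x) := a :* b :* x) refl N r y ⟩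
    N * r * y     ≡⟨ cong (_* y) (fromℕℚ*frac-1 (suc n)) ⟩
    1ℚ * y        ≡⟨ *-identityˡ y ⟩
    y             ∎
    where
    N = fromℕℚ (suc n)
    r = frac 1 (suc n)

  fromℕℚ*fromℕℚ*weight : ∀ n → fromℕℚ (suc n) * fromℕℚ (suc (suc n)) * weight n ≡ 1ℚ
  fromℕℚ*fromℕℚ*weight n = begin
    N₁ * N₂ * weight n       ≡⟨ cong (N₁ * N₂ *_) (frac-1-* (suc n) (suc (suc n))) ⟩
    N₁ * N₂ * (r₁ * r₂)      ≡⟨ solve 4 (λ a b x y → a :* b :* (x :* y) := (a :* x) :* (b :* y)) refl N₁ N₂ r₁ r₂ ⟩
    (N₁ * r₁) * (N₂ * r₂)    ≡⟨ cong₂ _*_ (fromℕℚ*frac-1 (suc n)) (fromℕℚ*frac-1 (suc (suc n))) ⟩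
    1ℚ * 1ℚ                  ≡⟨ *-identityˡ 1ℚ ⟩
    1ℚ                       ∎
    where
    N₁ = fromℕℚ (suc n)
    N₂ = fromℕℚ (suc (suc n))
    r₁ = frac 1 (suc n)
    r₂ = frac 1 (suc (suc n))

  G-recurrence : ∀ k n → fromℕℚ (suc n) * G (suc n) k ≡ two * sumTo (suc n) (λ i → G i k) + fromℕℚ (suc n) * g (suc n) k
  G-recurrence k n = trans (Ahat-recurrence k n) (cong (λ z → two * z + fromℕℚ (suc n) * g (suc n) k)
    (trans (sumTo-cong (suc n) (λ i → trans (*-identityˡ _) (Ahat≡G k (n ∸ i))))
           (sym (sumTo-reverse (suc n) (λ i → G i k)))))

  -- Solving the recurrence: the invariant is ∑_{j<n} G_j = n (n + 1) I_n.
  G-closed-form-from : ∀ k n → sumTo n (λ j → G j k) ≡ fromℕℚ n * fromℕℚ (suc n) * I k n →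
                       G n k ≡ g n k + two * fromℕℚ (suc n) * I k n
  G-closed-form-from k zero    _   =
    sym (trans (cong (_+ two * 1ℚ * 0ℚ) (sym (Bhat≡g k 0))) (trans (+-identityˡ (two * 1ℚ * 0ℚ)) (*-zeroʳ (two * 1ℚ))))
  G-closed-form-from k (suc n) ∑G≡ = fromℕℚ-*-cancelˡ n (begin
    N₁ * G (suc n) k                                 ≡⟨ G-recurrence k n ⟩
    two * sumTo (suc n) (λ i → G i k) + N₁ * g (suc n) k ≡⟨ cong (λ z → two * z + N₁ * g (suc n) k) ∑G≡ ⟩
    two * (N₁ * N₂ * I k (suc n)) + N₁ * g (suc n) k
      ≡⟨ solve 5 (λ t a b i x → t :* (a :* b :* i) :+ a :* x := a :* (x :+ t :* b :* i)) refl two N₁ N₂ (I k (suc n)) (g (suc n) k) ⟩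
    N₁ * (g (suc n) k + two * N₂ * I k (suc n))      ∎)
    where
    N₁ = fromℕℚ (suc n)
    N₂ = fromℕℚ (suc (suc n))

  ∑G-closed-form : ∀ k n → sumTo n (λ j → G j k) ≡ fromℕℚ n * fromℕℚ (suc n) * I k n
  ∑G-closed-form k zero    = refl
  ∑G-closed-form k (suc n) = begin
    sumTo n (λ j → G j k) + G n k
      ≡⟨ cong₂ _+_ (∑G-closed-form k n) (G-closed-form-from k n (∑G-closed-form k n)) ⟩
    a * N₁ * I k n + (g n k + two * N₁ * I k n)
      ≡⟨ cong (λ t → a * N₁ * I k n + (g n k + t * N₁ * I k n)) (fromℕℚ-+ 1 1) ⟩
    a * N₁ * I k n + (g n k + (1ℚ + 1ℚ) * N₁ * I k n)
      ≡⟨ solve 5 (λ a b i x o → a :* b :* i :+ (x :+ (o :+ o) :* b :* i) := b :* (o :+ (o :+ a)) :* i :+ x)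
                 refl a N₁ (I k n) (g n k) 1ℚ ⟩
    N₁ * (1ℚ + (1ℚ + a)) * I k n + g n k
      ≡⟨ cong₂ (λ z u → N₁ * z * I k n + u) N₂≡ (*-identityʳ (g n k)) ⟨
    N₁ * N₂ * I k n + g n k * 1ℚ
      ≡⟨ cong (λ z → N₁ * N₂ * I k n + g n k * z) (fromℕℚ*fromℕℚ*weight n) ⟨
    N₁ * N₂ * I k n + g n k * (N₁ * N₂ * weight n)
      ≡⟨ solve 5 (λ a b i x w → a :* b :* i :+ x :* (a :* b :* w) := a :* b :* (i :+ x :* w)) refl N₁ N₂ (I k n) (g n k) (weight n) ⟩
    N₁ * N₂ * (I k n + g n k * weight n)
      ≡⟨ cong (N₁ * N₂ *_) (I-suc k n) ⟨
    N₁ * N₂ * I k (suc n) ∎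
    where
    a = fromℕℚ n
    N₁ = fromℕℚ (suc n)
    N₂ = fromℕℚ (suc (suc n))
    N₂≡ : N₂ ≡ 1ℚ + (1ℚ + a)
    N₂≡ = trans (fromℕℚ-+ 1 (suc n)) (cong (1ℚ +_) (fromℕℚ-+ 1 n))

  G-closed-form : ∀ k n → G n k ≡ g n k + two * fromℕℚ (suc n) * I k n
  G-closed-form k n = G-closed-form-from k n (∑G-closed-form k n)

  fromℕℚ-suc-*-frac-1 : ∀ m .{{_ : ℕ.NonZero m}} → fromℕℚ (suc m) * frac 1 m ≡ frac 1 m + 1ℚ
  fromℕℚ-suc-*-frac-1 m = begin
    fromℕℚ (suc m) * frac 1 m              ≡⟨ cong (_* frac 1 m) (fromℕℚ-+ 1 m) ⟩
    (1ℚ + fromℕℚ m) * frac 1 m             ≡⟨ *-distribʳ-+ (frac 1 m) 1ℚ (fromℕℚ m) ⟩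
    1ℚ * frac 1 m + fromℕℚ m * frac 1 m    ≡⟨ cong₂ _+_ (*-identityˡ (frac 1 m)) (fromℕℚ*frac-1 m) ⟩
    frac 1 m + 1ℚ                          ∎

  G/n-decomposition : ∀ k n M →
    G (suc n) k * frac 1 (suc n) - two * I k M
    ≡ (g (suc n) k * frac 1 (suc n) + two * (I k (suc n) * frac 1 (suc n))) + two * (I k (suc n) - I k M)
  G/n-decomposition k n M = begin
    G n′ k * r - two * I k M
      ≡⟨ cong (λ z → z * r - two * I k M) (G-closed-form k n′) ⟩
    (g n′ k + two * fromℕℚ (suc n′) * I k n′) * r - two * I k M
      ≡⟨ solve 6 (λ x t a i r m → (x :+ t :* a :* i) :* r :- t :* m := x :* r :+ t :* i :* (a :* r) :- t :* m)
                 refl (g n′ k) two (fromℕℚ (suc n′)) (I k n′) r (I k M) ⟩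
    g n′ k * r + two * I k n′ * (fromℕℚ (suc n′) * r) - two * I k M
      ≡⟨ cong (λ z → g n′ k * r + two * I k n′ * z - two * I k M) (fromℕℚ-suc-*-frac-1 n′) ⟩
    g n′ k * r + two * I k n′ * (r + 1ℚ) - two * I k M
      ≡⟨ solve 5 (λ x t i r m → x :* r :+ t :* i :* (r :+ con 1ℚ) :- t :* m := x :* r :+ t :* (i :* r) :+ t :* (i :- m))
                 refl (g n′ k) two (I k n′) r (I k M) ⟩
    (g n′ k * r + two * (I k n′ * r)) + two * (I k n′ - I k M) ∎
    where
    n′ = suc n
    r = frac 1 n′

module Asymptotics where

  open import Data.Nat as ℕ using (ℕ; zero; suc; _^_; _!; NonZero; z≤n; s≤s)
  open import Data.Nat.Properties as ℕ using (_!≢0; m^n≢0; m*n≢0)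
  open import Data.Integer using (+[1+_]; -[1+_])
  import Data.Integer as ℤ
  open import Data.Rational using (ℚ; mkℚ; 0ℚ; 1ℚ; _+_; _*_; _-_; _/_; _≤_; _<_; ∣_∣; *<*; nonNegative)
  open import Data.Rational.Properties as ℚ
    using (≤-refl; ≤-trans; +-mono-≤; +-monoˡ-≤; +-monoʳ-≤; *-monoʳ-≤-nonNeg; *-monoˡ-≤-nonNeg
          ; neg-antimono-≤; ∣p∣≡p∨∣p∣≡-p; ∣p+q∣≤∣p∣+∣q∣; ∣p*q∣≡∣p∣*∣q∣; 0≤p⇒∣p∣≡p; ↥p/↧p≡p)
  import Data.Rational.Solver
  open Data.Rational.Solver.+-*-Solver using (solve; _:+_; _:*_; _:-_; :-_; _:=_; con)
  open import Data.List using (length)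
  open import Data.Product using (∃; _,_)
  open import Data.Sum using (inj₁; inj₂)
  open import Relation.Nullary using (yes; no)
  open import Relation.Binary.Definitions using (Reflexive; Transitive)
  open import Relation.Binary.PropositionalEquality

  open import Defs
  open Shapes
  open Sums
  open Permutations using (shapes)
  open Splitting using (length-shapes)
  open Fractions
  open Recurrences
  open ClosedForm

  leavesAt-≤ : ∀ d t → leavesAt d t ℕ.≤ 2 ^ d
  leavesAt-≤ d       nil                       = z≤n
  leavesAt-≤ zero    (node nil _ nil)          = s≤s z≤n
  leavesAt-≤ zero    (node (node _ _ _) _ _)   = z≤n
  leavesAt-≤ zero    (node nil _ (node _ _ _)) = z≤n
  leavesAt-≤ (suc d) (node l _ r) =
    subst (leavesAt d l ℕ.+ leavesAt d r ℕ.≤_) (cong (2 ^ d ℕ.+_) (sym (ℕ.+-identityʳ (2 ^ d))))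
          (ℕ.+-mono-≤ (leavesAt-≤ d l) (leavesAt-≤ d r))

  rootPairs-≤ : ∀ k t → rootPairs k t ℕ.≤ 2 ^ k
  rootPairs-≤ k t with rank t ℕ.≟ k
  ... | yes refl = subst (ℕ._≤ 2 ^ rank t) (sym (rootPairs-≤rank (rank t) t ℕ.≤-refl)) (leavesAt-≤ (rank t) t)
  ... | no r≢k = subst (ℕ._≤ 2 ^ k) (sym (rootPairs-≢ k t r≢k)) z≤n

  module _ {A : Set} {_∼_ : A → A → Set} (∼-refl : Reflexive _∼_) (∼-trans : Transitive _∼_) where

    stepwise-mono : (f : ℕ → A) → (∀ n → f n ∼ f (suc n)) → ∀ {a b} → a ℕ.≤ b → f a ∼ f b
    stepwise-mono f step {a} a≤b = subst (λ b → f a ∼ f b) (ℕ.m+[n∸m]≡n a≤b) (go (_ ℕ.∸ a))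
      where
      go : ∀ d → f a ∼ f (a ℕ.+ d)
      go zero    = subst (λ b → f a ∼ f b) (sym (ℕ.+-identityʳ a)) ∼-refl
      go (suc d) = subst (λ b → f a ∼ f b) (sym (ℕ.+-suc a d)) (∼-trans (go d) (step (a ℕ.+ d)))

  *-mono-≤-nonNeg : ∀ {p q r s} → 0ℚ ≤ p → 0ℚ ≤ r → p ≤ q → r ≤ s → p * r ≤ q * s
  *-mono-≤-nonNeg {p} {q} {r} {s} 0≤p 0≤r p≤q r≤s =
    ≤-trans (*-monoʳ-≤-nonNeg r {{nonNegative 0≤r}} p≤q) (*-monoˡ-≤-nonNeg q {{nonNegative (≤-trans 0≤p p≤q)}} r≤s)

  0≤+ : ∀ {p q} → 0ℚ ≤ p → 0ℚ ≤ q → 0ℚ ≤ p + q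
  0≤+ 0≤p 0≤q = +-mono-≤ 0≤p 0≤q

  0≤* : ∀ {p q} → 0ℚ ≤ p → 0ℚ ≤ q → 0ℚ ≤ p * q
  0≤* 0≤p 0≤q = *-mono-≤-nonNeg ≤-refl ≤-refl 0≤p 0≤q

  x-y≤d : ∀ {x y l d} → x ≤ l + d → l ≤ y → x - y ≤ d
  x-y≤d {x} {y} {l} {d} x≤l+d l≤y =
    subst (x - y ≤_) (solve 2 (λ l d → l :+ d :- l := d) refl l d) (+-mono-≤ x≤l+d (neg-antimono-≤ l≤y))

  ∣x-y∣≤d : ∀ {x y l d} → l ≤ x → x ≤ l + d → l ≤ y → y ≤ l + d → ∣ x - y ∣ ≤ d
  ∣x-y∣≤d {x} {y} l≤x x≤ l≤y y≤ with ∣p∣≡p∨∣p∣≡-p (x - y)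
  ... | inj₁ ∣x-y∣≡ = subst (_≤ _) (sym ∣x-y∣≡) (x-y≤d x≤ l≤y)
  ... | inj₂ ∣x-y∣≡ = subst (_≤ _) (sym (trans ∣x-y∣≡ (solve 2 (λ x y → :- (x :- y) := y :- x) refl x y))) (x-y≤d y≤ l≤x)

  weight-telescopes : ∀ n → weight n + frac 1 (suc (suc n)) ≡ frac 1 (suc n)
  weight-telescopes n = begin
    frac 1 D + frac 1 (suc (suc n))    ≡⟨ cong (frac 1 D +_) (frac-cross 1 (suc (suc n)) (suc n) D (ℕ.*-identityˡ D)) ⟩
    frac 1 D + frac (suc n) D          ≡⟨ frac-+ 1 (suc n) D ⟨
    frac (suc (suc n)) D               ≡⟨ frac-cross (suc (suc n)) D 1 (suc n)
                                            (trans (ℕ.*-comm (suc (suc n)) (suc n)) (sym (ℕ.*-identityˡ D))) ⟩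
    frac 1 (suc n)                     ∎
    where
    open ≡-Reasoning
    D = suc n ℕ.* suc (suc n)

  p≤p+q : ∀ {p q} → 0ℚ ≤ q → p ≤ p + q
  p≤p+q {p} 0≤q = subst (_≤ p + _) (ℚ.+-identityʳ p) (+-monoʳ-≤ p 0≤q)

  module Bounds (k : ℕ) where

    C : ℚ
    C = fromℕℚ (2 ^ k)

    0≤C : 0ℚ ≤ C
    0≤C = 0≤frac (2 ^ k) 1

    0≤g : ∀ m → 0ℚ ≤ g m k
    0≤g m = subst (0ℚ ≤_) (sym (g≡Eₛ m k)) (0≤frac (∑ (shapes m) (rootPairs k)) (m !) {{m !≢0}})

    g≤C : ∀ m → g m k ≤ C
    g≤C m = subst (_≤ C) (sym (g≡Eₛ m k)) (frac-≤ (∑ (shapes m) (rootPairs k)) (m !) (2 ^ k) 1 {{m !≢0}} bound)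
      where
      open ℕ.≤-Reasoning
      bound : ∑ (shapes m) (rootPairs k) ℕ.* 1 ℕ.≤ 2 ^ k ℕ.* m !
      bound = begin
        ∑ (shapes m) (rootPairs k) ℕ.* 1    ≡⟨ ℕ.*-identityʳ _ ⟩
        ∑ (shapes m) (rootPairs k)          ≤⟨ ∑-≤ (shapes m) (rootPairs-≤ k) ⟩
        length (shapes m) ℕ.* 2 ^ k         ≡⟨ cong (ℕ._* 2 ^ k) (length-shapes m) ⟩
        m ! ℕ.* 2 ^ k                       ≡⟨ ℕ.*-comm (m !) (2 ^ k) ⟩
        2 ^ k ℕ.* m !                       ∎

    I-step : ∀ n → I k n ≤ I k (suc n)
    I-step n = subst (I k n ≤_) (sym (I-suc k n)) (p≤p+q (0≤* (0≤g n) (0≤frac 1 (suc n ℕ.* suc (suc n)))))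

    I-mono : ∀ {a b} → a ℕ.≤ b → I k a ≤ I k b
    I-mono = stepwise-mono {_∼_ = _≤_} ≤-refl ≤-trans (I k) I-step

    envelope : ℕ → ℚ
    envelope n = I k n + C * frac 1 (suc n)

    -- The increments g_n w_n of I are at most C w_n = C/(n+1) - C/(n+2).
    envelope-step : ∀ n → envelope (suc n) ≤ envelope n
    envelope-step n = begin
      I k (suc n) + C * r₂                ≡⟨ cong (_+ C * r₂) (I-suc k n) ⟩
      I k n + g n k * weight n + C * r₂   ≤⟨ +-monoˡ-≤ (C * r₂) (+-monoʳ-≤ (I k n)
                                               (*-monoʳ-≤-nonNeg (weight n) {{nonNegative (0≤frac 1 (suc n ℕ.* suc (suc n)))}} (g≤C n))) ⟩
      I k n + C * weight n + C * r₂       ≡⟨ solve 4 (λ i c w r → i :+ c :* w :+ c :* r := i :+ c :* (w :+ r)) refl (I k n) C (weight n) r₂ ⟩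
      I k n + C * (weight n + r₂)         ≡⟨ cong (λ z → I k n + C * z) (weight-telescopes n) ⟩
      I k n + C * frac 1 (suc n)          ∎
      where
      open ℚ.≤-Reasoning
      r₂ = frac 1 (suc (suc n))

    I-tail : ∀ {a b} → a ℕ.≤ b → I k b ≤ I k a + C * frac 1 (suc a)
    I-tail {a} {b} a≤b = ≤-trans (p≤p+q (0≤* 0≤C (0≤frac 1 (suc b))))
                                 (stepwise-mono {_∼_ = λ x y → y ≤ x} ≤-refl (λ x y → ≤-trans y x) envelope envelope-step a≤b)

    0≤I : ∀ n → 0ℚ ≤ I k n
    0≤I n = I-mono {0} {n} z≤n

    I≤C : ∀ n → I k n ≤ C
    I≤C n = subst (I k n ≤_) (trans (ℚ.+-identityˡ (C * 1ℚ)) (ℚ.*-identityʳ C)) (I-tail {0} {n} z≤n)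

    G/n-window : ∀ N .{{_ : NonZero N}} n M → N ℕ.≤ suc n → N ℕ.≤ M →
      ∣ G (suc n) k * frac 1 (suc n) - two * I k M ∣ ≤ C * frac 1 N + two * (C * frac 1 N) + two * (C * frac 1 N)
    G/n-window N n M N≤n′ N≤M = begin
      ∣ G n′ k * r - two * I k M ∣               ≡⟨ cong ∣_∣ (G/n-decomposition k n M) ⟩
      ∣ Y + two * Z ∣                            ≤⟨ ∣p+q∣≤∣p∣+∣q∣ Y (two * Z) ⟩
      ∣ Y ∣ + ∣ two * Z ∣                        ≡⟨ cong₂ _+_ (0≤p⇒∣p∣≡p 0≤Y) (∣p*q∣≡∣p∣*∣q∣ two Z) ⟩
      Y + two * ∣ Z ∣                            ≤⟨ +-mono-≤ Y≤ (*-monoˡ-≤-nonNeg two ∣Z∣≤δ) ⟩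
      δ + two * δ + two * δ                      ∎
      where
      open ℚ.≤-Reasoning
      n′ = suc n
      r = frac 1 n′
      δ = C * frac 1 N
      Y = g n′ k * r + two * (I k n′ * r)
      Z = I k n′ - I k M
      0≤two : 0ℚ ≤ two
      0≤two = 0≤frac 2 1
      0≤r : 0ℚ ≤ r
      0≤r = 0≤frac 1 n′
      r≤1/N : r ≤ frac 1 N
      r≤1/N = frac-≤ 1 n′ 1 N (ℕ.*-monoʳ-≤ 1 N≤n′)
      ≤δ : ∀ {x} → 0ℚ ≤ x → x ≤ C → x * r ≤ δ
      ≤δ 0≤x x≤C = *-mono-≤-nonNeg 0≤x 0≤r x≤C r≤1/N
      0≤Y : 0ℚ ≤ Y
      0≤Y = 0≤+ (0≤* (0≤g n′) 0≤r) (0≤* 0≤two (0≤* (0≤I n′) 0≤r))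
      Y≤ : Y ≤ δ + two * δ
      Y≤ = +-mono-≤ (≤δ (0≤g n′) (g≤C n′)) (*-monoˡ-≤-nonNeg two {{nonNegative 0≤two}} (≤δ (0≤I n′) (I≤C n′)))
      window : ∀ {m} → N ℕ.≤ m → I k m ≤ I k N + δ
      window N≤m = ≤-trans (I-tail N≤m) (+-monoʳ-≤ (I k N)
        (*-monoˡ-≤-nonNeg C {{nonNegative 0≤C}} (frac-≤ 1 (suc N) 1 N (ℕ.*-monoʳ-≤ 1 (ℕ.n≤1+n N)))))
      ∣Z∣≤δ : ∣ Z ∣ ≤ δ
      ∣Z∣≤δ = ∣x-y∣≤d (I-mono N≤n′) (window N≤n′) (I-mono N≤M) (window N≤M)

  positive⇒frac : ∀ ε → 0ℚ < ε → ∃ λ p → ∃ λ q → ε ≡ frac (suc p) (suc q)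
  positive⇒frac ε@(mkℚ +[1+ p ] q _) _ = p , q , sym (↥p/↧p≡p ε)
  positive⇒frac (mkℚ (ℤ.+ 0) q _) (*<* (ℤ.+<+ ()))
  positive⇒frac (mkℚ -[1+ p ] q _) (*<* ())

  G/n-converges : ∀ k (ε : ℚ) → 0ℚ < ε → ∃ λ N → ∀ n M → N ℕ.≤ suc n → N ℕ.≤ M →
                  ∣ G (suc n) k * (ℤ.+ 1 / suc n) - two * intOneMinusX (Bhat k) M ∣ ≤ ε
  G/n-converges k ε 0<ε with positive⇒frac ε 0<ε
  ... | p , q , ε≡ = N , bound
    where
    open Bounds k
    instance
      2^k≢0 : NonZero (2 ^ k)
      2^k≢0 = m^n≢0 2 k
      N≢0 : NonZero (5 ℕ.* 2 ^ k ℕ.* suc q)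
      N≢0 = m*n≢0 (5 ℕ.* 2 ^ k) (suc q) {{m*n≢0 5 (2 ^ k)}}
    N = 5 ℕ.* 2 ^ k ℕ.* suc q
    δ = C * frac 1 N

    5δ≡ : δ + two * δ + two * δ ≡ frac 1 (suc q)
    5δ≡ = begin
      δ + two * δ + two * δ
        ≡⟨ solve 2 (λ t d → d :+ t :* d :+ t :* d := (con 1ℚ :+ t :+ t) :* d) refl two δ ⟩
      fromℕℚ 5 * (C * frac 1 N)
        ≡⟨ cong (λ z → fromℕℚ 5 * (C * z)) (trans (frac-1-* (5 ℕ.* 2 ^ k) (suc q) {{m*n≢0 5 (2 ^ k)}})
                                                  (cong (_* frac 1 (suc q)) (frac-1-* 5 (2 ^ k)))) ⟩
      fromℕℚ 5 * (C * (frac 1 5 * frac 1 (2 ^ k) * frac 1 (suc q)))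
        ≡⟨ solve 5 (λ f c a b x → f :* (c :* (a :* b :* x)) := (f :* a) :* (c :* b) :* x)
                   refl (fromℕℚ 5) C (frac 1 5) (frac 1 (2 ^ k)) (frac 1 (suc q)) ⟩
      (fromℕℚ 5 * frac 1 5) * (C * frac 1 (2 ^ k)) * frac 1 (suc q)
        ≡⟨ cong₂ (λ x y → x * y * frac 1 (suc q)) (fromℕℚ*frac-1 5) (fromℕℚ*frac-1 (2 ^ k)) ⟩
      1ℚ * 1ℚ * frac 1 (suc q)
        ≡⟨ solve 1 (λ x → con 1ℚ :* con 1ℚ :* x := x) refl (frac 1 (suc q)) ⟩
      frac 1 (suc q) ∎
      where open ≡-Reasoning

    δ≤ε : δ + two * δ + two * δ ≤ ε
    δ≤ε = subst₂ _≤_ (sym 5δ≡) (sym ε≡) (frac-≤ 1 (suc q) (suc p) (suc q) (ℕ.*-monoˡ-≤ (suc q) (s≤s (z≤n {p}))))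

    bound : ∀ n M → N ℕ.≤ suc n → N ℕ.≤ M → ∣ G (suc n) k * frac 1 (suc n) - two * I k M ∣ ≤ ε
    bound n M N≤n′ N≤M = ≤-trans (G/n-window N n M N≤n′ N≤M) δ≤ε

open Recurrences using (Ahat-recurrence; Bhat-recurrence; Bhat-base)
open Asymptotics using (G/n-converges)

open import Defs
open import Data.Nat using (ℕ; suc)
open import Data.Integer using (+_)
open import Data.Rational using (ℚ; _/_; 0ℚ; _<_; _≤_; _*_; _-_; ∣_∣)
open import Data.Product using (_×_; ∃; _,_)
open import Relation.Binary.PropositionalEquality using (_≡_)

lemma4p2 :
    (∀ k n → deriv (Ahat k) n ≡ (scale two (geom ⊗ Ahat k) ⊕ deriv (Bhat k)) n)
    × (∀ k n → deriv (Bhat (suc k)) n ≡ scale two ((oneS ⊕ Bge k) ⊗ Bhat k) n)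
    × (∀ n → Bhat 0 n ≡ xS n)
    × (∀ k (ε : ℚ) → 0ℚ < ε → ∃ λ N → ∀ n M → N Data.Nat.≤ suc n → N Data.Nat.≤ M →
         ∣ G (suc n) k * (+ 1 / suc n) - two * intOneMinusX (Bhat k) M ∣ ≤ ε)
lemma4p2 = Ahat-recurrence , Bhat-recurrence , Bhat-base , G/n-converges
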